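{- Let $k\geq 2$. (1) The oriented de Bruijn graphs $\vec{B}_{k,N}$, regarded as unlabeled oriented graphs, converge as $N\to\infty$ in the sense of Benjamini–Schramm to the oriented Cayley graph $\vec{\mathrm{Cay}}(\mathcal L_k,X_k)$. (2) Regarding all graphs as unlabeled oriented graphs and all convergences in the sense of Benjamini–Schramm, the following hold and are compatible (the corresponding diagram of limits commutes): for every fixed $M\in\{1,2,\dots\}$, $\vec{SW}_{k,N,M}\to\vec{\mathrm{Cay}}(\mathcal L_k,X_k)$ as $N\to\infty$; for every fixed $N\geq 0$, $\vec{SW}_{k,N,M}\to\vec{SW}_{k,N,\infty}$ as $M\to\infty$; $\vec{SW}_{k,N,\infty}\to\vec{\mathrm{Cay}}(\mathcal L_k,X_k)$ as $N\to\infty$; and $\vec{SW}_{k,N,M}\to\vec{\mathrm{Cay}}(\mathcal L_k,X_k)$ as $N,M\to\infty$ simultaneously.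
   Context: Graphs may have loops and multiple edges. An oriented graph consists of a vertex set $V$, an edge set $E$ and maps $\iota,\tau\colon E\to V$ (initial and terminal vertex). Fix $k\geq 2$. For $N\in\{0,1,2,\dots\}$ and $M\in\{1,2,\dots\}\cup\{\infty\}$, the oriented spider-web graph $\vec{SW}_{k,N,M}$ is the oriented graph with vertex set $\{0,\dots,k-1\}^N\times\mathbb Z/M\mathbb Z$ (where $\mathbb Z/\infty\mathbb Z:=\mathbb Z$) in which each vertex $(x_1\dots x_N,i)$ has exactly $k$ outgoing edges, labeled $R_0,\dots,R_{k-1}$, the one labeled $R_y$ ending at $(x_2\dots x_Ny,\,i+1)$. The oriented de Bruijn graph $\vec B_{k,N}$ is $\vec{SW}_{k,N,1}$ (vertex set $\{0,\dots,k-1\}^N$, an edge labeled $R_y$ from $x_1\dots x_N$ to $x_2\dots x_Ny$). The lamplighter group is $\mathcal L_k=(\mathbb Z/k\mathbb Z)\wr\mathbb Z=(\bigoplus_{\mathbb Z}\mathbb Z/k\mathbb Z)\rtimes\mathbb Z$, where the generator $b$ of $\mathbb Z$ acts by shifting coordinates; $c$ denotes the generator of the copy of $\mathbb Z/k\mathbb Z$ at coordinate $0$. Let $\bar c_r=c^rb$ for $0\le r\le k-1$ and $X_k=\{\bar c_0,\dots,\bar c_{k-1}\}$. The oriented Cayley graph $\vec{\mathrm{Cay}}(\mathcal L_k,X_k)$ has vertex set $\mathcal L_k$ and an edge from $g$ to $gx$ for each $x\in X_k$. Space of rooted graphs: isomorphism classes of connected rooted oriented graphs, with distance $1/(1+r)$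 where $r$ is the largest radius for which the balls of radius $r$ (in the underlying non-oriented graphs, with orientation kept) around the roots are isomorphic as rooted oriented graphs. For a finite graph $\Gamma$, $\lambda_\Gamma$ is the law of the connected component of a uniformly random root; a sequence $\Gamma_n$ converges in the sense of Benjamini–Schramm to a graph $\Gamma$ whose rooted versions are all isomorphic (vertex-transitive) if $\lambda_{\Gamma_n}$ converges weakly to the Dirac mass at $(\Gamma,v)$; the graphs $\vec{SW}_{k,N,\infty}$ are vertex-transitive, and for them the associated measure is the Dirac mass at the graph rooted at any vertex. -}

module Defs where

open import Level using (0ℓ)
open import Data.Nat using (ℕ; zero; suc; _+_; _*_; _≤_; NonZero)
open import Data.Nat.DivMod using (_mod_)
open import Data.Fin as Fin using (Fin; toℕ)
open import Data.Integer as ℤ using (ℤ)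
open import Data.Vec as Vec using (Vec; []; _∷_; _∷ʳ_)
open import Data.Vec.Properties as VecP using (∷-injectiveˡ; ∷-injectiveʳ)
open import Data.List as List using (List; length; cartesianProduct; cartesianProductWith; allFin; _++_)
open import Data.List.Membership.Propositional using (_∈_; _∉_)
open import Data.List.Membership.Propositional.Properties
  using (∈-cartesianProductWith⁺; ∈-cartesianProduct⁺; ∈-allFin; ∈-++⁻; ∈-map⁺)
open import Data.List.Relation.Unary.Any as Any using (Any)
open import Data.List.Relation.Unary.Unique.Propositional.Properties as UniqueP
  using (cartesianProductWith⁺; cartesianProduct⁺; allFin⁺)
import Data.List.Relation.Unary.Unique.Setoid as USetoid
open import Data.List.Relation.Unary.Unique.Propositional using (Unique; []; _∷_)
open import Data.List.Relation.Unary.All using ([])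
open import Data.Product using (Σ; ∃; _×_; _,_; proj₁; proj₂)
open import Data.Sum using (inj₁; inj₂)
open import Relation.Nullary using (¬_; yes; no)
open import Relation.Binary using (Rel; IsEquivalence; Setoid)
open import Relation.Binary.PropositionalEquality
  using (_≡_; refl; sym; trans; cong; isEquivalence; subst)

-- Vertex and edge sets are equipped with an equivalence relation
-- (for the concrete graphs below this is ≡, except for the lamplighter
-- group, whose elements involve functions ℤ → ℤ/kℤ compared pointwise).

record OGraph : Set₁ where
  field
    V       : Set
    _≈_     : Rel V 0ℓ
    ≈-equiv : IsEquivalence _≈_
    E       : Set
    _≈ᴱ_    : Rel E 0ℓ
    ≈ᴱ-equiv : IsEquivalence _≈ᴱ_
    ι τ     : E → V
    ι-cong  : ∀ {e e'} → e ≈ᴱ e' → ι e ≈ ι e'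
    τ-cong  : ∀ {e e'} → e ≈ᴱ e' → τ e ≈ τ e'

open OGraph

data InBall (G : OGraph) (u : V G) : ℕ → V G → Set where
  root : ∀ {r x} → _≈_ G u x → InBall G u r x
  fwd  : ∀ {r x} (e : E G) → InBall G u r (ι G e) → _≈_ G (τ G e) x →
         InBall G u (suc r) x
  bwd  : ∀ {r x} (e : E G) → InBall G u r (τ G e) → _≈_ G (ι G e) x →
         InBall G u (suc r) x

InBallᴱ : (G : OGraph) → V G → ℕ → E G → Set
InBallᴱ G u r e = InBall G u r (ι G e) × InBall G u r (τ G e)

record Rooted : Set₁ where
  constructor _,root_
  field
    graph : OGraph
    rt    : V graph

open Rooted

record BallIso (r : ℕ) (A B : Rooted) : Set where
  private
    G = graph A
    H = graph B
    u = rt A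
    v = rt B
  field
    φ  : V G → V H
    ψ  : V H → V G
    φᴱ : E G → E H
    ψᴱ : E H → E G
    φ-cong  : ∀ {x y} → _≈_ G x y → _≈_ H (φ x) (φ y)
    ψ-cong  : ∀ {x y} → _≈_ H x y → _≈_ G (ψ x) (ψ y)
    φᴱ-cong : ∀ {e f} → _≈ᴱ_ G e f → _≈ᴱ_ H (φᴱ e) (φᴱ f)
    ψᴱ-cong : ∀ {e f} → _≈ᴱ_ H e f → _≈ᴱ_ G (ψᴱ e) (ψᴱ f)
    φ-root  : _≈_ H (φ u) v
    φ-ball  : ∀ {x} → InBall G u r x → InBall H v r (φ x)
    ψ-ball  : ∀ {y} → InBall H v r y → InBall G u r (ψ y)
    ψφ      : ∀ {x} → InBall G u r x → _≈_ G (ψ (φ x)) x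
    φψ      : ∀ {y} → InBall H v r y → _≈_ H (φ (ψ y)) y
    φᴱ-ι    : ∀ {e} → InBallᴱ G u r e → _≈_ H (ι H (φᴱ e)) (φ (ι G e))
    φᴱ-τ    : ∀ {e} → InBallᴱ G u r e → _≈_ H (τ H (φᴱ e)) (φ (τ G e))
    ψᴱ-ι    : ∀ {f} → InBallᴱ H v r f → _≈_ G (ι G (ψᴱ f)) (ψ (ι H f))
    ψᴱ-τ    : ∀ {f} → InBallᴱ H v r f → _≈_ G (τ G (ψᴱ f)) (ψ (τ H f))
    ψφᴱ     : ∀ {e} → InBallᴱ G u r e → _≈ᴱ_ G (ψᴱ (φᴱ e)) e
    φψᴱ     : ∀ {f} → InBallᴱ H v r f → _≈ᴱ_ H (φᴱ (ψᴱ f)) f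

vSetoid : OGraph → Setoid 0ℓ 0ℓ
vSetoid G = record { Carrier = V G ; _≈_ = _≈_ G ; isEquivalence = ≈-equiv G }

record FinOGraph : Set₁ where
  field
    graph    : OGraph
    verts    : List (V graph)
    unique   : USetoid.Unique (vSetoid graph) verts
    complete : ∀ x → Any (_≈_ graph x) verts

open FinOGraph

-- The λ_Γ-measure of the set of rooted graphs whose r-ball is NOT
-- isomorphic to that of L is at most 1/m: all "bad" roots are covered
-- by a list of length ≤ |V Γ| / m.
BadFraction≤ : ℕ → ℕ → FinOGraph → Rooted → Set
BadFraction≤ r m Γ L =
  Σ (List (V (FinOGraph.graph Γ))) λ bad →
    (∀ x → ¬ BallIso r (FinOGraph.graph Γ ,root x) L →
           Any (_≈_ (FinOGraph.graph Γ) x) bad)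
    × m * length bad ≤ length (verts Γ)

-- Benjamini–Schramm convergence Γ_N → (Γ,v) with (Γ,v) vertex-transitive,
-- i.e. λ_{Γ_N} → Dirac mass at (Γ,v) weakly: for each radius r, the
-- proportion of roots whose r-ball differs from that of (Γ,v) tends to 0.
BSConverges : (ℕ → FinOGraph) → Rooted → Set
BSConverges Γ L = ∀ r m → ∃ λ N₀ → ∀ N → N₀ ≤ N → BadFraction≤ r m (Γ N) L

BSConverges₂ : (ℕ → ℕ → FinOGraph) → Rooted → Set
BSConverges₂ Γ L =
  ∀ r m → ∃ λ N₀ → ∀ N M → N₀ ≤ N → N₀ ≤ M → BadFraction≤ r m (Γ N M) L

-- Convergence of vertex-transitive (Dirac) limits: δ_{(Γ_N,v_N)} → δ_{(Γ,v)}
-- weakly iff (Γ_N,v_N) → (Γ,v) in the space of rooted graphs.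
RootedConverges : (ℕ → Rooted) → Rooted → Set
RootedConverges Γ L = ∀ r → ∃ λ N₀ → ∀ N → N₀ ≤ N → BallIso r (Γ N) L

_+ₖ_ : ∀ {k} .{{_ : NonZero k}} → Fin k → Fin k → Fin k
_+ₖ_ {k} a b = (toℕ a + toℕ b) mod k

0ₖ : ∀ {k} .{{_ : NonZero k}} → Fin k
0ₖ {k} = 0 mod k

0+0 : ∀ {k} .{{_ : NonZero k}} → (0ₖ {k} +ₖ 0ₖ {k}) ≡ 0ₖ {k}
0+0 {suc k} = refl

shiftIn : ∀ {A : Set} {N} → Vec A N → A → Vec A N
shiftIn []       y = []
shiftIn (x ∷ xs) y = xs ∷ʳ y

≡-graph : (V' : Set) (E' : Set) (ι' τ' : E' → V') → OGraph
≡-graph V' E' ι' τ' = record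
  { V = V' ; _≈_ = _≡_ ; ≈-equiv = isEquivalence
  ; E = E' ; _≈ᴱ_ = _≡_ ; ≈ᴱ-equiv = isEquivalence
  ; ι = ι' ; τ = τ' ; ι-cong = cong ι' ; τ-cong = cong τ' }

-- ℤ/Mℤ for M = suc M' ∈ {1,2,…}
SWfinGraph : (k N M' : ℕ) → OGraph
SWfinGraph k N M' =
  ≡-graph (Vec (Fin k) N × Fin (suc M')) ((Vec (Fin k) N × Fin (suc M')) × Fin k)
          proj₁
          (λ { ((w , i) , y) → (shiftIn w y , (toℕ i + 1) mod (suc M')) })

-- ℤ/∞ℤ = ℤ
SWinfGraph : (k N : ℕ) → OGraph
SWinfGraph k N =
  ≡-graph (Vec (Fin k) N × ℤ) ((Vec (Fin k) N × ℤ) × Fin k)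
          proj₁
          (λ { ((w , i) , y) → (shiftIn w y , i ℤ.+ ℤ.+ 1) })

allVecs : ∀ k N → List (Vec (Fin k) N)
allVecs k zero    = [] List.∷ List.[]
allVecs k (suc N) = cartesianProductWith _∷_ (allFin k) (allVecs k N)

allVecs-complete : ∀ {k N} (w : Vec (Fin k) N) → w ∈ allVecs k N
allVecs-complete []       = Any.here refl
allVecs-complete (x ∷ w) =
  ∈-cartesianProductWith⁺ _∷_ (∈-allFin x) (allVecs-complete w)

allVecs-unique : ∀ k N → Unique (allVecs k N)
allVecs-unique k zero    = [] ∷ []
allVecs-unique k (suc N) =
  cartesianProductWith⁺ _∷_ (λ eq → ∷-injectiveˡ eq , ∷-injectiveʳ eq)
    (allFin⁺ k) (allVecs-unique k N)

SWfin : (k N M' : ℕ) → FinOGraph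
SWfin k N M' = record
  { graph    = SWfinGraph k N M'
  ; verts    = cartesianProduct (allVecs k N) (allFin (suc M'))
  ; unique   = cartesianProduct⁺ (allVecs-unique k N) (allFin⁺ (suc M'))
  ; complete = λ { (w , i) → ∈-cartesianProduct⁺ (allVecs-complete w) (∈-allFin i) }
  }

-- oriented de Bruijn graph  B_{k,N} = SW_{k,N,1}
deBruijn : (k N : ℕ) → FinOGraph
deBruijn k N = SWfin k N 0

-- SW_{k,N,∞} rooted at 0…0 (vertex-transitive, so any root will do)
SWinfRooted : (k N : ℕ) .{{_ : NonZero k}} → Rooted
SWinfRooted k N = SWinfGraph k N ,root (Vec.replicate N 0ₖ , ℤ.0ℤ)

module _ (k : ℕ) .{{_ : NonZero k}} where

  FinSupp : (ℤ → Fin k) → Set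
  FinSupp f = Σ (List ℤ) λ S → ∀ z → z ∉ S → f z ≡ 0ₖ

  record Lamp : Set where
    constructor lamp
    field
      conf    : ℤ → Fin k
      finSupp : FinSupp conf
      pos     : ℤ

  open Lamp

  _≈L_ : Rel Lamp 0ℓ
  g ≈L h = (∀ z → conf g z ≡ conf h z) × pos g ≡ pos h

  -- group law: (f , n) · (g , m) = (f + b^n g b^{-n} , n + m),
  -- where (b^n g b^{-n})(z) = g (z - n)
  shiftSupp : ℤ → List ℤ → List ℤ
  shiftSupp n S = List.map (λ t → n ℤ.+ t) S

  private
    addSupp : (f g : ℤ → Fin k) (n : ℤ) → FinSupp f → FinSupp g →
              FinSupp (λ z → f z +ₖ g (z ℤ.- n))
    addSupp f g n (S , hS) (T , hT) = S ++ shiftSupp n T , pf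
      where
      open import Data.List.Membership.Propositional.Properties using (∈-++⁺ˡ; ∈-++⁺ʳ)
      open import Data.Integer.Properties using (+-comm; +-assoc; +-inverseˡ; +-identityˡ; +-identityʳ)
      lem : ∀ z → n ℤ.+ (z ℤ.- n) ≡ z
      lem z = trans (cong (λ t → n ℤ.+ t) (+-comm z (ℤ.- n)))
              (trans (sym (+-assoc n (ℤ.- n) z))
              (trans (cong (λ t → t ℤ.+ z) (trans (+-comm n (ℤ.- n)) (+-inverseˡ n))) (+-identityˡ z)))
      pf : ∀ z → z ∉ (S ++ shiftSupp n T) → (f z +ₖ g (z ℤ.- n)) ≡ 0ₖ
      pf z z∉ rewrite hS z (λ p → z∉ (∈-++⁺ˡ p))
                    | hT (z ℤ.- n) (λ p → z∉ (∈-++⁺ʳ S (subst (_∈ shiftSupp n T) (lem z) (∈-map⁺ (λ t → n ℤ.+ t) p))))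
                    = 0+0

  _·_ : Lamp → Lamp → Lamp
  lamp f sf n · lamp g sg m = lamp (λ z → f z +ₖ g (z ℤ.- n)) (addSupp f g n sf sg) (n ℤ.+ m)

  e : Lamp
  e = lamp (λ _ → 0ₖ) (List.[] , λ _ _ → refl) ℤ.0ℤ

  c : Lamp
  c = lamp δ₀ ((ℤ.0ℤ List.∷ List.[]) , pf) ℤ.0ℤ
    where
    δ₀ : ℤ → Fin k
    δ₀ z with z ℤ.≟ ℤ.0ℤ
    ... | yes _ = 1 mod k
    ... | no  _ = 0ₖ
    pf : ∀ z → z ∉ (ℤ.0ℤ List.∷ List.[]) → δ₀ z ≡ 0ₖ
    pf z z∉ with z ℤ.≟ ℤ.0ℤ
    ... | yes z≡0 = Data.Empty.⊥-elim (z∉ (Any.here z≡0))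
      where import Data.Empty
    ... | no  _   = refl

  b : Lamp
  b = lamp (λ _ → 0ₖ) (List.[] , λ _ _ → refl) (ℤ.+ 1)

  _^ᴸ_ : Lamp → ℕ → Lamp
  g ^ᴸ zero  = e
  g ^ᴸ suc n = g · (g ^ᴸ n)

  c̄ : Fin k → Lamp
  c̄ r = (c ^ᴸ toℕ r) · b

  CayGraph : OGraph
  CayGraph = record
    { V = Lamp ; _≈_ = _≈L_
    ; ≈-equiv = record
        { refl  = (λ _ → refl) , refl
        ; sym   = λ (p , q) → (λ z → sym (p z)) , sym q
        ; trans = λ (p , q) (p' , q') → (λ z → trans (p z) (p' z)) , trans q q' }
    ; E = Lamp × Fin k
    ; _≈ᴱ_ = λ x y → proj₁ x ≈L proj₁ y × proj₂ x ≡ proj₂ y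
    ; ≈ᴱ-equiv = record
        { refl  = ((λ _ → refl) , refl) , refl
        ; sym   = λ ((p , q) , t) → ((λ z → sym (p z)) , sym q) , sym t
        ; trans = λ ((p , q) , t) ((p' , q') , t') →
                    ((λ z → trans (p z) (p' z)) , trans q q') , trans t t' }
    ; ι = proj₁
    ; τ = λ x → proj₁ x · c̄ (proj₂ x)
    ; ι-cong = proj₁
    ; τ-cong = λ {x} {y} → τc {x} {y}
    }
    where
    τc : ∀ {x y : Lamp × Fin k} → (proj₁ x ≈L proj₁ y × proj₂ x ≡ proj₂ y) →
         (proj₁ x · c̄ (proj₂ x)) ≈L (proj₁ y · c̄ (proj₂ y))
    τc {lamp f _ n , r} {lamp g _ m , .r} ((p , refl) , refl) =
      (λ z → Relation.Binary.PropositionalEquality.cong₂ _+ₖ_ (p z) refl) , refl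
      where import Relation.Binary.PropositionalEquality

  CayRooted : Rooted
  CayRooted = CayGraph ,root e

module Submission where

-- The Cayley graph of L_k covers SW_{k,N,∞}, and SW_{k,N,∞} covers every SW_{k,N,M}; a
-- covering map with a left inverse on the (r+1)-ball around the root is an isomorphism of
-- r-balls. The lamps of a point in the (r+1)-ball of the Cayley graph lie in a window of
-- width 2(r+1), so the first covering is invertible there once N ≥ 4(r+1). The second
-- covering, rooted at (w , i), is invertible on the (r+1)-ball unless two distinct offsets
-- d, d' ∈ [-(r+1), r+1] reach the same ℤ/Mℤ-coordinate while w agrees with its shift by
-- d' - d on a long window. This never happens for M > 2(r+1); in general it makes w periodic,
-- with period < 2(r+1), on a stretch of Lc letters, which is the case for at most a fraction
-- 2(r+1)/k^Lc of all words. Lc = 2(r+1)m gives the bound 1/m; the de Bruijn graph is M = 1.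

open import Defs hiding (e; c)
open import Data.Nat using (ℕ; zero; suc; NonZero)
open import Data.Fin using (Fin; toℕ)
open import Data.Vec using (Vec)
open import Data.Nat.DivMod using (_mod_)
open import Relation.Binary.PropositionalEquality

module ModularArithmetic {k : ℕ} .{{_ : NonZero k}} where

  open import Data.Nat using (_+_; _∸_; ≢-nonZero⁻¹)
  open import Data.Nat.Properties using (+-comm; +-assoc; m+[n∸m]≡n; <⇒≤; n≢0⇒n>0)
  open import Data.Nat.DivMod using (_%_; m%n<n; m<n⇒m%n≡m; n%n≡0; m%n%n≡m%n; %-distribˡ-+)
  open import Data.Fin.Properties using (toℕ-fromℕ<; toℕ-injective; toℕ<n)
  open ≡-Reasoning

  toℕ-mod : ∀ m → toℕ (m mod k) ≡ m % k
  toℕ-mod m = toℕ-fromℕ< (m%n<n m k)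

  toℕ-+ₖ : ∀ (a b : Fin k) → toℕ (a +ₖ b) ≡ (toℕ a + toℕ b) % k
  toℕ-+ₖ a b = toℕ-mod (toℕ a + toℕ b)

  toℕ-0ₖ : toℕ (0ₖ {k}) ≡ 0
  toℕ-0ₖ = trans (toℕ-mod 0) (m<n⇒m%n≡m (n≢0⇒n>0 (≢-nonZero⁻¹ k)))

  toℕ%k≡toℕ : ∀ (a : Fin k) → toℕ a % k ≡ toℕ a
  toℕ%k≡toℕ a = m<n⇒m%n≡m (toℕ<n a)

  toℕ-mod-fin : ∀ (a : Fin k) → toℕ a mod k ≡ a
  toℕ-mod-fin a = toℕ-injective (trans (toℕ-mod (toℕ a)) (toℕ%k≡toℕ a))

  +ₖ-comm : ∀ (a b : Fin k) → a +ₖ b ≡ b +ₖ a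
  +ₖ-comm a b = cong (_mod k) (+-comm (toℕ a) (toℕ b))

  +ₖ-identityˡ : ∀ (a : Fin k) → 0ₖ +ₖ a ≡ a
  +ₖ-identityˡ a = toℕ-injective (begin
    toℕ (0ₖ +ₖ a)              ≡⟨ toℕ-+ₖ 0ₖ a ⟩
    (toℕ (0ₖ {k}) + toℕ a) % k ≡⟨ cong (λ t → (t + toℕ a) % k) toℕ-0ₖ ⟩
    toℕ a % k                  ≡⟨ toℕ%k≡toℕ a ⟩
    toℕ a                      ∎)

  +ₖ-identityʳ : ∀ (a : Fin k) → a +ₖ 0ₖ ≡ a
  +ₖ-identityʳ a = trans (+ₖ-comm a 0ₖ) (+ₖ-identityˡ a)

  [m%k+n]%k≡[m+n]%k : ∀ m n → (m % k + n) % k ≡ (m + n) % k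
  [m%k+n]%k≡[m+n]%k m n = begin
    (m % k + n) % k            ≡⟨ %-distribˡ-+ (m % k) n k ⟩
    (m % k % k + n % k) % k    ≡⟨ cong (λ t → (t + n % k) % k) (m%n%n≡m%n m k) ⟩
    (m % k + n % k) % k        ≡⟨ sym (%-distribˡ-+ m n k) ⟩
    (m + n) % k                ∎

  [m+n%k]%k≡[m+n]%k : ∀ m n → (m + n % k) % k ≡ (m + n) % k
  [m+n%k]%k≡[m+n]%k m n = begin
    (m + n % k) % k  ≡⟨ cong (_% k) (+-comm m (n % k)) ⟩
    (n % k + m) % k  ≡⟨ [m%k+n]%k≡[m+n]%k n m ⟩
    (n + m) % k      ≡⟨ cong (_% k) (+-comm n m) ⟩
    (m + n) % k      ∎

  +ₖ-assoc : ∀ (a b c : Fin k) → (a +ₖ b) +ₖ c ≡ a +ₖ (b +ₖ c)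
  +ₖ-assoc a b c = toℕ-injective (begin
    toℕ ((a +ₖ b) +ₖ c)                ≡⟨ toℕ-+ₖ (a +ₖ b) c ⟩
    (toℕ (a +ₖ b) + toℕ c) % k         ≡⟨ cong (λ t → (t + toℕ c) % k) (toℕ-+ₖ a b) ⟩
    ((toℕ a + toℕ b) % k + toℕ c) % k  ≡⟨ [m%k+n]%k≡[m+n]%k (toℕ a + toℕ b) (toℕ c) ⟩
    (toℕ a + toℕ b + toℕ c) % k        ≡⟨ cong (_% k) (+-assoc (toℕ a) (toℕ b) (toℕ c)) ⟩
    (toℕ a + (toℕ b + toℕ c)) % k      ≡⟨ sym ([m+n%k]%k≡[m+n]%k (toℕ a) (toℕ b + toℕ c)) ⟩
    (toℕ a + (toℕ b + toℕ c) % k) % k  ≡⟨ cong (λ t → (toℕ a + t) % k) (sym (toℕ-+ₖ b c)) ⟩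
    (toℕ a + toℕ (b +ₖ c)) % k         ≡⟨ sym (toℕ-+ₖ a (b +ₖ c)) ⟩
    toℕ (a +ₖ (b +ₖ c))                ∎)

  -ₖ_ : Fin k → Fin k
  -ₖ a = (k ∸ toℕ a) mod k

  +ₖ-inverseʳ : ∀ (a : Fin k) → a +ₖ (-ₖ a) ≡ 0ₖ
  +ₖ-inverseʳ a = toℕ-injective (begin
    toℕ (a +ₖ (-ₖ a))                   ≡⟨ toℕ-+ₖ a (-ₖ a) ⟩
    (toℕ a + toℕ (-ₖ a)) % k            ≡⟨ cong (λ t → (toℕ a + t) % k) (toℕ-mod (k ∸ toℕ a)) ⟩
    (toℕ a + (k ∸ toℕ a) % k) % k       ≡⟨ [m+n%k]%k≡[m+n]%k (toℕ a) (k ∸ toℕ a) ⟩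
    (toℕ a + (k ∸ toℕ a)) % k           ≡⟨ cong (_% k) (m+[n∸m]≡n (<⇒≤ (toℕ<n a))) ⟩
    k % k                               ≡⟨ n%n≡0 k ⟩
    0                                   ≡⟨ sym toℕ-0ₖ ⟩
    toℕ (0ₖ {k})                        ∎)

  _-ₖ_ : Fin k → Fin k → Fin k
  a -ₖ b = a +ₖ (-ₖ b)

  +ₖ-inverseˡ : ∀ (a : Fin k) → (-ₖ a) +ₖ a ≡ 0ₖ
  +ₖ-inverseˡ a = trans (+ₖ-comm (-ₖ a) a) (+ₖ-inverseʳ a)

  a+b-b≡a : ∀ (a b : Fin k) → (a +ₖ b) -ₖ b ≡ a
  a+b-b≡a a b = begin
    (a +ₖ b) +ₖ (-ₖ b)  ≡⟨ +ₖ-assoc a b (-ₖ b) ⟩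
    a +ₖ (b +ₖ (-ₖ b))  ≡⟨ cong (a +ₖ_) (+ₖ-inverseʳ b) ⟩
    a +ₖ 0ₖ             ≡⟨ +ₖ-identityʳ a ⟩
    a                   ∎

  a-b+b≡a : ∀ (a b : Fin k) → (a -ₖ b) +ₖ b ≡ a
  a-b+b≡a a b = begin
    (a +ₖ (-ₖ b)) +ₖ b  ≡⟨ +ₖ-assoc a (-ₖ b) b ⟩
    a +ₖ ((-ₖ b) +ₖ b)  ≡⟨ cong (a +ₖ_) (+ₖ-inverseˡ b) ⟩
    a +ₖ 0ₖ             ≡⟨ +ₖ-identityʳ a ⟩
    a                   ∎

  b+[a-b]≡a : ∀ (a b : Fin k) → b +ₖ (a -ₖ b) ≡ a
  b+[a-b]≡a a b = trans (+ₖ-comm b (a -ₖ b)) (a-b+b≡a a b)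

  +ₖ-cancelʳ : ∀ {a b : Fin k} c → a +ₖ c ≡ b +ₖ c → a ≡ b
  +ₖ-cancelʳ {a} {b} c eq = trans (sym (a+b-b≡a a c)) (trans (cong (_-ₖ c) eq) (a+b-b≡a b c))

  +ₖ-cancelˡ : ∀ {a b : Fin k} c → c +ₖ a ≡ c +ₖ b → a ≡ b
  +ₖ-cancelˡ {a} {b} c eq = +ₖ-cancelʳ c (trans (+ₖ-comm a c) (trans eq (+ₖ-comm c b)))

module Balls where

  open import Data.Product using (Σ; _×_; _,_)
  open import Relation.Binary using (IsEquivalence)
  open OGraph
  open Rooted using (graph; rt)

  module _ {G : OGraph} where
    private module G = IsEquivalence (≈-equiv G)

    InBall-suc : ∀ {u r x} → InBall G u r x → InBall G u (suc r) x
    InBall-suc (root p)    = root p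
    InBall-suc (fwd e p q) = fwd e (InBall-suc p) q
    InBall-suc (bwd e p q) = bwd e (InBall-suc p) q

    InBall-resp-≈ : ∀ {u r x y} → InBall G u r x → _≈_ G x y → InBall G u r y
    InBall-resp-≈ (root p)     q = root (G.trans p q)
    InBall-resp-≈ (fwd e p p') q = fwd e p (G.trans p' q)
    InBall-resp-≈ (bwd e p p') q = bwd e p (G.trans p' q)

  BallIso-sym : ∀ {r A B} → BallIso r A B → BallIso r B A
  BallIso-sym {r} {A} {B} I = record
    { φ = ψ ; ψ = φ ; φᴱ = ψᴱ ; ψᴱ = φᴱ
    ; φ-cong = ψ-cong ; ψ-cong = φ-cong ; φᴱ-cong = ψᴱ-cong ; ψᴱ-cong = φᴱ-cong
    ; φ-root = A.trans (ψ-cong (B.sym φ-root)) (ψφ (root A.refl))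
    ; φ-ball = ψ-ball ; ψ-ball = φ-ball ; ψφ = φψ ; φψ = ψφ
    ; φᴱ-ι = ψᴱ-ι ; φᴱ-τ = ψᴱ-τ ; ψᴱ-ι = φᴱ-ι ; ψᴱ-τ = φᴱ-τ
    ; ψφᴱ = φψᴱ ; φψᴱ = ψφᴱ }
    where
    open BallIso I
    module A = IsEquivalence (≈-equiv (graph A))
    module B = IsEquivalence (≈-equiv (graph B))

  BallIso-trans : ∀ {r A B C} → BallIso r A B → BallIso r B C → BallIso r A C
  BallIso-trans {r} {A} {B} {C} I J = record
    { φ  = λ x → J.φ (I.φ x)   ; ψ  = λ z → I.ψ (J.ψ z)
    ; φᴱ = λ e → J.φᴱ (I.φᴱ e) ; ψᴱ = λ f → I.ψᴱ (J.ψᴱ f)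
    ; φ-cong  = λ p → J.φ-cong (I.φ-cong p)
    ; ψ-cong  = λ p → I.ψ-cong (J.ψ-cong p)
    ; φᴱ-cong = λ p → J.φᴱ-cong (I.φᴱ-cong p)
    ; ψᴱ-cong = λ p → I.ψᴱ-cong (J.ψᴱ-cong p)
    ; φ-root  = C.trans (J.φ-cong I.φ-root) J.φ-root
    ; φ-ball  = λ p → J.φ-ball (I.φ-ball p)
    ; ψ-ball  = λ p → I.ψ-ball (J.ψ-ball p)
    ; ψφ   = λ p → A.trans (I.ψ-cong (J.ψφ (I.φ-ball p))) (I.ψφ p)
    ; φψ   = λ p → C.trans (J.φ-cong (I.φψ (J.ψ-ball p))) (J.φψ p)
    ; φᴱ-ι = λ p → C.trans (J.φᴱ-ι (φᴱ-ball p)) (J.φ-cong (I.φᴱ-ι p))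
    ; φᴱ-τ = λ p → C.trans (J.φᴱ-τ (φᴱ-ball p)) (J.φ-cong (I.φᴱ-τ p))
    ; ψᴱ-ι = λ p → A.trans (I.ψᴱ-ι (ψᴱ-ball p)) (I.ψ-cong (J.ψᴱ-ι p))
    ; ψᴱ-τ = λ p → A.trans (I.ψᴱ-τ (ψᴱ-ball p)) (I.ψ-cong (J.ψᴱ-τ p))
    ; ψφᴱ  = λ p → Aᴱ.trans (I.ψᴱ-cong (J.ψφᴱ (φᴱ-ball p))) (I.ψφᴱ p)
    ; φψᴱ  = λ p → Cᴱ.trans (J.φᴱ-cong (I.φψᴱ (ψᴱ-ball p))) (J.φψᴱ p)
    }
    where
    module I = BallIso I
    module J = BallIso J
    module A = IsEquivalence (≈-equiv (graph A))
    module B = IsEquivalence (≈-equiv (graph B))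
    module C = IsEquivalence (≈-equiv (graph C))
    module Aᴱ = IsEquivalence (≈ᴱ-equiv (graph A))
    module Cᴱ = IsEquivalence (≈ᴱ-equiv (graph C))
    φᴱ-ball : ∀ {e} → InBallᴱ (graph A) (rt A) r e → InBallᴱ (graph B) (rt B) r (I.φᴱ e)
    φᴱ-ball (p , q) = InBall-resp-≈ (I.φ-ball p) (B.sym (I.φᴱ-ι (p , q)))
                    , InBall-resp-≈ (I.φ-ball q) (B.sym (I.φᴱ-τ (p , q)))
    ψᴱ-ball : ∀ {f} → InBallᴱ (graph C) (rt C) r f → InBallᴱ (graph B) (rt B) r (J.ψᴱ f)
    ψᴱ-ball (p , q) = InBall-resp-≈ (J.ψ-ball p) (B.sym (J.ψᴱ-ι (p , q)))
                    , InBall-resp-≈ (J.ψ-ball q) (B.sym (J.ψᴱ-τ (p , q)))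

  -- A map π onto an ≡-graph H that is bijective on the outgoing edges and surjective on the
  -- incoming edges at every vertex lifts every path of H from π u, so it maps the r-ball
  -- onto the r-ball; a left inverse of π on the (r+1)-ball makes it injective there.
  module Covering (G : OGraph) (V' E' : Set) (ι' τ' : E' → V') (u : V G) (v : V') (r : ℕ) where
    H : OGraph
    H = ≡-graph V' E' ι' τ'

    record Covering : Set where
      field
        π               : V G → V'
        πᴱ              : E G → E'
        π-cong          : ∀ {x y} → _≈_ G x y → π x ≡ π y
        πᴱ-cong         : ∀ {e f} → _≈ᴱ_ G e f → πᴱ e ≡ πᴱ f
        π-ι             : ∀ e → ι' (πᴱ e) ≡ π (ι G e)
        π-τ             : ∀ e → τ' (πᴱ e) ≡ π (τ G e)
        liftOut         : V G → E' → E G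
        liftOut-ι       : ∀ x h → ι' h ≡ π x → _≈_ G (ι G (liftOut x h)) x
        π-liftOut       : ∀ x h → ι' h ≡ π x → πᴱ (liftOut x h) ≡ h
        liftIn          : ∀ x h → τ' h ≡ π x → Σ (E G) λ e → _≈_ G (τ G e) x × πᴱ e ≡ h
        πᴱ-injectiveOut : ∀ e e' → _≈_ G (ι G e) (ι G e') → πᴱ e ≡ πᴱ e' → _≈ᴱ_ G e e'
        section         : V' → V G
        section-π       : ∀ x → InBall G u (suc r) x → _≈_ G (section (π x)) x
        π-root          : π u ≡ v

    module _ (C : Covering) where
      open Covering C
      private module G = IsEquivalence (≈-equiv G)

      π-ball : ∀ {t x} → InBall G u t x → InBall H v t (π x)
      π-ball (root p)    = root (trans (sym π-root) (π-cong p))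
      π-ball (fwd e p q) = fwd (πᴱ e) (subst (InBall H v _) (sym (π-ι e)) (π-ball p)) (trans (π-τ e) (π-cong q))
      π-ball (bwd e p q) = bwd (πᴱ e) (subst (InBall H v _) (sym (π-τ e)) (π-ball p)) (trans (π-ι e) (π-cong q))

      liftBall : ∀ {t y} → InBall H v t y → Σ (V G) λ x → InBall G u t x × π x ≡ y
      liftBall (root p) = u , root G.refl , trans π-root p
      liftBall (fwd h p q) with liftBall p
      ... | x , bx , eq = τ G e , fwd e (InBall-resp-≈ bx (G.sym (liftOut-ι x h (sym eq)))) G.refl
                        , trans (sym (π-τ e)) (trans (cong τ' (π-liftOut x h (sym eq))) q)
        where e = liftOut x h
      liftBall (bwd h p q) with liftBall p
      ... | x , bx , eq with liftIn x h (sym eq)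
      ... | e , τe≈x , πe≡h = ι G e , bwd e (InBall-resp-≈ bx (G.sym τe≈x)) G.refl
                            , trans (sym (π-ι e)) (trans (cong ι' πe≡h) q)

      section-π′ : ∀ {x} → InBall G u r x → _≈_ G (section (π x)) x
      section-π′ b = section-π _ (InBall-suc b)

      section-ball : ∀ {y} → InBall H v r y → InBall G u r (section y)
      section-ball b with liftBall b
      ... | x , bx , refl = InBall-resp-≈ bx (G.sym (section-π′ bx))

      π-section : ∀ {y} → InBall H v r y → π (section y) ≡ y
      π-section b with liftBall b
      ... | x , bx , refl = π-cong (section-π′ bx)

      section-cong : ∀ {a b} → a ≡ b → _≈_ G (section a) (section b)
      section-cong refl = G.refl

      sectionᴱ : E' → E G
      sectionᴱ h = liftOut (section (ι' h)) h

      π-ballᴱ : ∀ e → InBall G u r (ι G e) → InBall H v r (ι' (πᴱ e))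
      π-ballᴱ e p = subst (InBall H v r) (sym (π-ι e)) (π-ball p)

      sectionᴱ-τ : ∀ f → InBall H v r (ι' f) → _≈_ G (τ G (sectionᴱ f)) (section (τ' f))
      sectionᴱ-τ f p = G.sym (G.trans (section-cong (trans (cong τ' (sym (π-liftOut _ f eq))) (π-τ e)))
                                      (section-π _ τe∈ball))
        where
        eq = sym (π-section p)
        e = sectionᴱ f
        τe∈ball : InBall G u (suc r) (τ G e)
        τe∈ball = fwd e (InBall-resp-≈ (section-ball p) (G.sym (liftOut-ι _ f eq))) G.refl

      sectionᴱ-πᴱ : ∀ e → InBall G u r (ι G e) → _≈ᴱ_ G (sectionᴱ (πᴱ e)) e
      sectionᴱ-πᴱ e p = πᴱ-injectiveOut _ _
        (G.trans (liftOut-ι _ _ eq) (G.trans (section-cong (π-ι e)) (section-π′ p)))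
        (π-liftOut _ _ eq)
        where eq = sym (π-section (π-ballᴱ e p))

      covering⇒BallIso : BallIso r (G ,root u) (H ,root v)
      covering⇒BallIso = record
        { φ = π ; ψ = section ; φᴱ = πᴱ ; ψᴱ = sectionᴱ
        ; φ-cong  = π-cong
        ; ψ-cong  = section-cong
        ; φᴱ-cong = πᴱ-cong
        ; ψᴱ-cong = λ { refl → IsEquivalence.refl (≈ᴱ-equiv G) }
        ; φ-root  = π-root
        ; φ-ball  = π-ball
        ; ψ-ball  = section-ball
        ; ψφ      = section-π′
        ; φψ      = π-section
        ; φᴱ-ι    = λ {e} _ → π-ι e
        ; φᴱ-τ    = λ {e} _ → π-τ e
        ; ψᴱ-ι    = λ {f} (p , _) → liftOut-ι (section (ι' f)) f (sym (π-section p))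
        ; ψᴱ-τ    = λ {f} (p , _) → sectionᴱ-τ f p
        ; ψφᴱ     = λ {e} (p , _) → sectionᴱ-πᴱ e p
        ; φψᴱ     = λ {f} (p , _) → π-liftOut (section (ι' f)) f (sym (π-section p))
        }

-- Each inequality between linear forms below is proved by writing b as a + c, with c a sum
-- of visibly nonnegative terms; the identity b ≡ a + c is discharged by the ring solver.
module LinearArithmetic where

  open import Data.Integer using (ℤ; +_; -[1+_]; 0ℤ; _-_; -_; _≤_; +≤+) renaming (_+_ to _⊕_)
  open import Data.Integer.Properties using (+-identityʳ; +-monoʳ-≤; +-mono-≤; ≤-trans; neg-mono-≤; i≤j⇒i≤1+j)
  open import Data.Integer.Properties public using (i≤j⇒0≤j-i)
  open import Data.Integer.Tactic.RingSolver using (solve-∀)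
  open import Data.Nat using (z≤n)
  open import Data.Nat.Properties using (n≤1+n)
  open import Data.Sum using (_⊎_; inj₁; inj₂)
  open import Data.Empty using (⊥)
  open import Relation.Nullary using (¬_)

  ≤-from-slack : ∀ {a b} c → b ≡ a ⊕ c → 0ℤ ≤ c → a ≤ b
  ≤-from-slack {a} c eq 0≤c = subst₂ _≤_ (+-identityʳ a) (sym eq) (+-monoʳ-≤ a 0≤c)

  0≤+ : ∀ n → 0ℤ ≤ + n
  0≤+ n = +≤+ z≤n

  0≤-⊕ : ∀ {x y} → 0ℤ ≤ x → 0ℤ ≤ y → 0ℤ ≤ x ⊕ y
  0≤-⊕ = +-mono-≤

  0≰-[1+n] : ∀ {n} → ¬ (0ℤ ≤ -[1+ n ])
  0≰-[1+n] ()

  i≡j+[i-j] : ∀ i j → i ≡ j ⊕ (i - j)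
  i≡j+[i-j] = solve-∀

  -- The lamps of a vertex at distance ≤ t from the root live in [-t, t); Outside t is the complement.
  Outside : ℕ → ℤ → Set
  Outside t z = (z ⊕ + 1 ≤ - + t) ⊎ (+ t ≤ z)

  private
    lo-fwd : ∀ n t → n ⊕ + 1 ≡ - (+ 1 ⊕ t) ⊕ ((n - - t) ⊕ + 2)
    lo-fwd = solve-∀
    hi-fwd : ∀ n t → + 1 ⊕ t ≡ (n ⊕ + 1) ⊕ (t - n)
    hi-fwd = solve-∀
    lo-bwd : ∀ n t → n ≡ - (+ 1 ⊕ t) ⊕ (n ⊕ + 1 - - t)
    lo-bwd = solve-∀
    hi-bwd : ∀ n t → + 1 ⊕ t ≡ n ⊕ ((t - (n ⊕ + 1)) ⊕ + 2)
    hi-bwd = solve-∀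
    gap-lo : ∀ z s → (z - - s) ⊕ (- s - (z ⊕ + 1)) ≡ - (+ 1)
    gap-lo = solve-∀
    gap-hi : ∀ z s → (s - (z ⊕ + 1)) ⊕ (z - s) ≡ - (+ 1)
    gap-hi = solve-∀
    shrink-lo : ∀ z t → - t ≡ (z ⊕ + 1) ⊕ ((- (+ 1 ⊕ t) - (z ⊕ + 1)) ⊕ + 1)
    shrink-lo = solve-∀
    shrink-hi : ∀ z t → z ≡ t ⊕ ((z - (+ 1 ⊕ t)) ⊕ + 1)
    shrink-hi = solve-∀

  -‿≤-suc : ∀ {n t} → - + t ≤ n → - + suc t ≤ n ⊕ + 1
  -‿≤-suc {n} {t} h = ≤-from-slack _ (lo-fwd n (+ t)) (0≤-⊕ (i≤j⇒0≤j-i h) (0≤+ 2))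

  ≤-suc : ∀ {n t} → n ≤ + t → n ⊕ + 1 ≤ + suc t
  ≤-suc {n} {t} h = ≤-from-slack _ (hi-fwd n (+ t)) (i≤j⇒0≤j-i h)

  -‿≤-pred : ∀ {n t} → - + t ≤ n ⊕ + 1 → - + suc t ≤ n
  -‿≤-pred {n} {t} h = ≤-from-slack _ (lo-bwd n (+ t)) (i≤j⇒0≤j-i h)

  ≤-pred : ∀ {n t} → n ⊕ + 1 ≤ + t → n ≤ + suc t
  ≤-pred {n} {t} h = ≤-from-slack _ (hi-bwd n (+ t)) (0≤-⊕ (i≤j⇒0≤j-i h) (0≤+ 2))

  -‿≤-weaken : ∀ {n t} → - + t ≤ n → - + suc t ≤ n
  -‿≤-weaken {t = t} = ≤-trans (neg-mono-≤ (+≤+ (n≤1+n t)))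

  ≤-weaken : ∀ {n t} → n ≤ + t → n ≤ + suc t
  ≤-weaken = i≤j⇒i≤1+j

  Outside-suc⇒Outside : ∀ {t z} → Outside (suc t) z → Outside t z
  Outside-suc⇒Outside {t} {z} (inj₁ h) = inj₁ (≤-from-slack _ (shrink-lo z (+ t)) (0≤-⊕ (i≤j⇒0≤j-i h) (0≤+ 1)))
  Outside-suc⇒Outside {t} {z} (inj₂ h) = inj₂ (≤-from-slack _ (shrink-hi z (+ t)) (0≤-⊕ (i≤j⇒0≤j-i h) (0≤+ 1)))

  Outside⇒≢ : ∀ {s n z} → Outside s z → - + s ≤ n → n ⊕ + 1 ≤ + s → z ≢ n
  Outside⇒≢ {s} {z = z} (inj₁ hz) h _ refl =
    0≰-[1+n] (subst (0ℤ ≤_) (gap-lo z (+ s)) (0≤-⊕ (i≤j⇒0≤j-i h) (i≤j⇒0≤j-i hz)))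
  Outside⇒≢ {s} {z = z} (inj₂ hz) _ h refl =
    0≰-[1+n] (subst (0ℤ ≤_) (gap-hi z (+ s)) (0≤-⊕ (i≤j⇒0≤j-i h) (i≤j⇒0≤j-i hz)))

module LamplighterGroup {k : ℕ} .{{_ : NonZero k}} where

  open ModularArithmetic {k}
  open import Data.Nat using (_+_)
  open import Data.Nat.DivMod using (_%_; %-distribˡ-+)
  open import Data.Fin.Properties using (toℕ-injective)
  open import Data.Integer using (ℤ; +_; 0ℤ; _-_) renaming (_+_ to _⊕_)
  open import Data.Integer.Properties using (+-identityʳ; +-inverseʳ; i-j≡0⇒i≡j; _≟_)
  open import Data.Empty using (⊥-elim)
  open import Relation.Nullary using (yes; no)
  open Lamp public using (conf; pos)
  open ≡-Reasoning

  _⋆_ : Lamp k → Lamp k → Lamp k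
  _⋆_ = _·_ k

  cⁿ : ℕ → Lamp k
  cⁿ = _^ᴸ_ k (Defs.c k)

  pos-cⁿ : ∀ n → pos (cⁿ n) ≡ 0ℤ
  pos-cⁿ zero    = refl
  pos-cⁿ (suc n) = cong (0ℤ ⊕_) (pos-cⁿ n)

  conf-c-≢0 : ∀ z → z ≢ 0ℤ → conf (Defs.c k) z ≡ 0ₖ
  conf-c-≢0 z z≢0 with z ≟ 0ℤ
  ... | yes z≡0 = ⊥-elim (z≢0 z≡0)
  ... | no  _   = refl

  conf-cⁿ-0 : ∀ n → conf (cⁿ n) 0ℤ ≡ n mod k
  conf-cⁿ-0 zero    = refl
  conf-cⁿ-0 (suc n) = toℕ-injective (begin
    toℕ ((1 mod k) +ₖ conf (cⁿ n) 0ℤ)   ≡⟨ cong (λ a → toℕ ((1 mod k) +ₖ a)) (conf-cⁿ-0 n) ⟩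
    toℕ ((1 mod k) +ₖ (n mod k))        ≡⟨ toℕ-+ₖ (1 mod k) (n mod k) ⟩
    (toℕ (1 mod k) + toℕ (n mod k)) % k ≡⟨ cong₂ (λ a b → (a + b) % k) (toℕ-mod 1) (toℕ-mod n) ⟩
    (1 % k + n % k) % k                 ≡⟨ sym (%-distribˡ-+ 1 n k) ⟩
    suc n % k                           ≡⟨ sym (toℕ-mod (suc n)) ⟩
    toℕ (suc n mod k)                   ∎)

  conf-cⁿ-≢0 : ∀ n z → z ≢ 0ℤ → conf (cⁿ n) z ≡ 0ₖ
  conf-cⁿ-≢0 zero    z _    = refl
  conf-cⁿ-≢0 (suc n) z z≢0 = begin
    conf (Defs.c k) z +ₖ conf (cⁿ n) (z ⊕ 0ℤ) ≡⟨ cong₂ _+ₖ_ (conf-c-≢0 z z≢0) (cong (conf (cⁿ n)) (+-identityʳ z)) ⟩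
    0ₖ +ₖ conf (cⁿ n) z                       ≡⟨ cong (0ₖ +ₖ_) (conf-cⁿ-≢0 n z z≢0) ⟩
    0ₖ +ₖ 0ₖ                                  ≡⟨ 0+0 ⟩
    0ₖ                                        ∎

  pos-⋆cⁿ : ∀ g n → pos (g ⋆ cⁿ n) ≡ pos g
  pos-⋆cⁿ g n = trans (cong (pos g ⊕_) (pos-cⁿ n)) (+-identityʳ (pos g))

  conf-⋆cⁿ-pos : ∀ g n → conf (g ⋆ cⁿ n) (pos g) ≡ conf g (pos g) +ₖ (n mod k)
  conf-⋆cⁿ-pos g n = cong (conf g (pos g) +ₖ_) (trans (cong (conf (cⁿ n)) (+-inverseʳ (pos g))) (conf-cⁿ-0 n))

  conf-⋆cⁿ-≢pos : ∀ g n z → z ≢ pos g → conf (g ⋆ cⁿ n) z ≡ conf g z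
  conf-⋆cⁿ-≢pos g n z z≢pos = trans (cong (conf g z +ₖ_) (conf-cⁿ-≢0 n (z - pos g) (λ eq → z≢pos (i-j≡0⇒i≡j z (pos g) eq))))
                                    (+ₖ-identityʳ (conf g z))

  pos-⋆c̄ : ∀ g r → pos (g ⋆ c̄ k r) ≡ pos g ⊕ + 1
  pos-⋆c̄ g r = cong (λ p → pos g ⊕ (p ⊕ + 1)) (pos-cⁿ (toℕ r))

  conf-⋆c̄-pos : ∀ g r → conf (g ⋆ c̄ k r) (pos g) ≡ conf g (pos g) +ₖ r
  conf-⋆c̄-pos g r = cong (conf g (pos g) +ₖ_) (begin
    conf (cⁿ (toℕ r)) (pos g - pos g) +ₖ 0ₖ ≡⟨ +ₖ-identityʳ _ ⟩
    conf (cⁿ (toℕ r)) (pos g - pos g)       ≡⟨ cong (conf (cⁿ (toℕ r))) (+-inverseʳ (pos g)) ⟩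
    conf (cⁿ (toℕ r)) 0ℤ                    ≡⟨ conf-cⁿ-0 (toℕ r) ⟩
    toℕ r mod k                            ≡⟨ toℕ-mod-fin r ⟩
    r                                      ∎)

  conf-⋆c̄-≢pos : ∀ g r z → z ≢ pos g → conf (g ⋆ c̄ k r) z ≡ conf g z
  conf-⋆c̄-≢pos g r z z≢pos = trans (cong (conf g z +ₖ_) (begin
    conf (cⁿ (toℕ r)) (z - pos g) +ₖ 0ₖ ≡⟨ +ₖ-identityʳ _ ⟩
    conf (cⁿ (toℕ r)) (z - pos g)       ≡⟨ conf-cⁿ-≢0 (toℕ r) (z - pos g) (λ eq → z≢pos (i-j≡0⇒i≡j z (pos g) eq)) ⟩
    0ₖ                                  ∎)) (+ₖ-identityʳ (conf g z))

-- Words are read through ℕ-indexed lookups, padded by a default letter beyond their length.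
module Words {A : Set} (default : A) where

  open import Data.Nat using (_<_; z≤n; s≤s)
  open import Data.Vec using (Vec; []; _∷_; _∷ʳ_; replicate)

  at : ∀ {N} → Vec A N → ℕ → A
  at []       l       = default
  at (x ∷ xs) zero    = x
  at (x ∷ xs) (suc l) = at xs l

  tab : ∀ N → (ℕ → A) → Vec A N
  tab zero    f = []
  tab (suc N) f = f 0 ∷ tab N (λ l → f (suc l))

  at-tab : ∀ N f l → l < N → at (tab N f) l ≡ f l
  at-tab (suc N) f zero    _       = refl
  at-tab (suc N) f (suc l) (s≤s h) = at-tab N (λ l → f (suc l)) l h

  tab-cong : ∀ N {f g : ℕ → A} → (∀ l → l < N → f l ≡ g l) → tab N f ≡ tab N g
  tab-cong zero    _  = refl
  tab-cong (suc N) eq = cong₂ _∷_ (eq 0 (s≤s z≤n)) (tab-cong N (λ l h → eq (suc l) (s≤s h)))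

  at-ext : ∀ {N} (x y : Vec A N) → (∀ l → l < N → at x l ≡ at y l) → x ≡ y
  at-ext []      []      _  = refl
  at-ext (a ∷ x) (b ∷ y) eq = cong₂ _∷_ (eq 0 (s≤s z≤n)) (at-ext x y (λ l h → eq (suc l) (s≤s h)))

  at-∷ʳ-< : ∀ {N} (x : Vec A N) y l → l < N → at (x ∷ʳ y) l ≡ at x l
  at-∷ʳ-< (a ∷ x) y zero    _       = refl
  at-∷ʳ-< (a ∷ x) y (suc l) (s≤s h) = at-∷ʳ-< x y l h

  at-∷ʳ-last : ∀ {N} (x : Vec A N) y → at (x ∷ʳ y) N ≡ y
  at-∷ʳ-last []      y = refl
  at-∷ʳ-last (a ∷ x) y = at-∷ʳ-last x y

  at-shiftIn-< : ∀ {N} (x : Vec A N) y l → suc l < N → at (shiftIn x y) l ≡ at x (suc l)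
  at-shiftIn-< (a ∷ x) y l (s≤s h) = at-∷ʳ-< x y l h

  at-shiftIn-last : ∀ {N} (x : Vec A N) y l → suc l ≡ N → at (shiftIn x y) l ≡ y
  at-shiftIn-last (a ∷ x) y l refl = at-∷ʳ-last x y

  at-replicate : ∀ N l → at (replicate N default) l ≡ default
  at-replicate zero    l       = refl
  at-replicate (suc N) zero    = refl
  at-replicate (suc N) (suc l) = at-replicate N l

-- For N ≥ 1 the map g ↦ (word g , pos g) is a covering of SW_{k,N,∞} by the Cayley graph:
-- letter l of word g is the sum of the lamps at pos g + l and pos g + l - N, so
-- multiplying by c̄ᵣ shifts the word and appends the letter g(pos g + N) + g(pos g) + r.
module CayleyCovering {k : ℕ} .{{_ : NonZero k}} (N₁ : ℕ) where

  open ModularArithmetic {k}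
  open LamplighterGroup {k}
  open Words (0ₖ {k})
  open import Data.Nat as ℕ using (_<_; _∸_; s≤s; z≤n)
  import Data.Nat.Properties as ℕP
  open import Data.Integer using (ℤ; +_; -[1+_]; 0ℤ; _+_; _-_; -_; _≤_; +≤+)
  import Data.Integer.Properties as ℤP
  open import Data.Integer.Tactic.RingSolver using (solve-∀)
  open import Data.Vec using (replicate)
  open import Data.List using (List; []; map; upTo; _++_)
  open import Data.List.Membership.Propositional using (_∈_; _∉_)
  open import Data.List.Membership.Propositional.Properties using (∈-upTo⁺; ∈-map⁺; ∈-++⁺ˡ; ∈-++⁺ʳ)
  open import Data.Empty using (⊥-elim)
  open LinearArithmetic
  open import Data.Product using (Σ; _×_; _,_; proj₁; proj₂)
  open import Data.Sum using (inj₁; inj₂)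
  open import Relation.Nullary using (yes; no)
  open ≡-Reasoning

  N : ℕ
  N = suc N₁

  SW∞ : OGraph
  SW∞ = SWinfGraph k N

  Vertex : Set
  Vertex = Vec (Fin k) N × ℤ

  Edge : Set
  Edge = Vertex × Fin k

  letter : Lamp k → ℕ → Fin k
  letter g l = conf g (pos g + + l) +ₖ conf g (pos g + + l - + N)

  word : Lamp k → Vec (Fin k) N
  word g = tab N (letter g)

  π : Lamp k → Vertex
  π g = word g , pos g

  lastLetter : Vec (Fin k) N → Fin k
  lastLetter x = at x N₁

  πᴱ : Lamp k × Fin k → Edge
  πᴱ (g , s) = π g , lastLetter (word (g ⋆ c̄ k s))

  private
    shift-pos : ∀ n a → (n + + 1) + a ≡ n + (+ 1 + a)
    shift-pos = solve-∀
    shift-pos-N : ∀ n a b → (n + + 1) + a - b ≡ n + (+ 1 + a) - b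
    shift-pos-N = solve-∀
    wrap : ∀ n a → (n + (+ 1 + a)) - (+ 1 + a) ≡ n
    wrap = solve-∀
    cancel-n : ∀ n a → (n + a) - n ≡ a
    cancel-n = solve-∀
    cancel-n-N : ∀ n a b → (n + a - b) - n ≡ a - b
    cancel-n-N = solve-∀
    cancel-N : ∀ n a → (n - a) - n ≡ - a
    cancel-N = solve-∀

  n+suc-l≢n : ∀ n l → n + + suc l ≢ n
  n+suc-l≢n n l eq with trans (sym (cancel-n n (+ suc l))) (trans (cong (_- n) eq) (ℤP.+-inverseʳ n))
  ... | ()

  n+suc-l-N≢n : ∀ n l → suc l < N → n + + suc l - + N ≢ n
  n+suc-l-N≢n n l h eq = ℕP.<⇒≢ h (ℤP.+-injective (ℤP.i-j≡0⇒i≡j _ _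
    (trans (sym (cancel-n-N n (+ suc l) (+ N))) (trans (cong (_- n) eq) (ℤP.+-inverseʳ n)))))

  n-N≢n : ∀ n → n - + N ≢ n
  n-N≢n n eq with trans (sym (cancel-N n (+ N))) (trans (cong (_- n) eq) (ℤP.+-inverseʳ n))
  ... | ()

  at-word : ∀ g l → l < N → at (word g) l ≡ letter g l
  at-word g l = at-tab N (letter g) l

  at-word-⋆c̄ : ∀ g s l → suc l < N → at (word (g ⋆ c̄ k s)) l ≡ at (word g) (suc l)
  at-word-⋆c̄ g s l h = begin
    at (word g') l                                                 ≡⟨ at-word g' l (ℕP.<-trans (ℕP.n<1+n l) h) ⟩
    conf g' (pos g' + + l) +ₖ conf g' (pos g' + + l - + N)         ≡⟨ cong (λ p → conf g' (p + + l) +ₖ conf g' (p + + l - + N)) (pos-⋆c̄ g s) ⟩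
    conf g' ((pos g + + 1) + + l) +ₖ conf g' ((pos g + + 1) + + l - + N)
      ≡⟨ cong₂ (λ a b → conf g' a +ₖ conf g' b) (shift-pos (pos g) (+ l)) (shift-pos-N (pos g) (+ l) (+ N)) ⟩
    conf g' (pos g + + suc l) +ₖ conf g' (pos g + + suc l - + N)
      ≡⟨ cong₂ _+ₖ_ (conf-⋆c̄-≢pos g s _ (n+suc-l≢n (pos g) l)) (conf-⋆c̄-≢pos g s _ (n+suc-l-N≢n (pos g) l h)) ⟩
    conf g (pos g + + suc l) +ₖ conf g (pos g + + suc l - + N)     ≡⟨ sym (at-word g (suc l) h) ⟩
    at (word g) (suc l)                                            ∎
    where g' = g ⋆ c̄ k s

  lastLetter-⋆c̄ : ∀ g s → lastLetter (word (g ⋆ c̄ k s)) ≡ conf g (pos g + + N) +ₖ (conf g (pos g) +ₖ s)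
  lastLetter-⋆c̄ g s = begin
    at (word g') N₁                                                    ≡⟨ at-word g' N₁ (ℕP.n<1+n N₁) ⟩
    conf g' (pos g' + + N₁) +ₖ conf g' (pos g' + + N₁ - + N)           ≡⟨ cong (λ p → conf g' (p + + N₁) +ₖ conf g' (p + + N₁ - + N)) (pos-⋆c̄ g s) ⟩
    conf g' ((pos g + + 1) + + N₁) +ₖ conf g' ((pos g + + 1) + + N₁ - + N)
      ≡⟨ cong₂ (λ a b → conf g' a +ₖ conf g' b) (shift-pos (pos g) (+ N₁)) (trans (shift-pos-N (pos g) (+ N₁) (+ N)) (wrap (pos g) (+ N₁))) ⟩
    conf g' (pos g + + N) +ₖ conf g' (pos g)                           ≡⟨ cong₂ _+ₖ_ (conf-⋆c̄-≢pos g s _ (n+suc-l≢n (pos g) N₁)) (conf-⋆c̄-pos g s) ⟩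
    conf g (pos g + + N) +ₖ (conf g (pos g) +ₖ s)                      ∎
    where g' = g ⋆ c̄ k s

  π-cong : ∀ {g h} → _≈L_ k g h → π g ≡ π h
  π-cong {g} {h} (conf≗ , pos≡) = cong₂ _,_ (tab-cong N (λ l _ → cong₂ _+ₖ_
    (trans (conf≗ _) (cong (λ t → conf h (t + + l)) pos≡))
    (trans (conf≗ _) (cong (λ t → conf h (t + + l - + N)) pos≡)))) pos≡

  π-τ : ∀ e → OGraph.τ SW∞ (πᴱ e) ≡ π (OGraph.τ (CayGraph k) e)
  π-τ (g , s) = cong₂ _,_ (at-ext _ _ letters) (sym (pos-⋆c̄ g s))
    where
    letters : ∀ l → l < N → at (shiftIn (word g) (lastLetter (word (g ⋆ c̄ k s)))) l ≡ at (word (g ⋆ c̄ k s)) l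
    letters l h with ℕP.m≤n⇒m<n∨m≡n h
    ... | inj₁ sl<N  = trans (at-shiftIn-< (word g) _ l sl<N) (sym (at-word-⋆c̄ g s l sl<N))
    ... | inj₂ refl  = at-shiftIn-last (word g) _ N₁ refl

  πᴱ-injectiveOut : ∀ e e' → _≈L_ k (proj₁ e) (proj₁ e') → πᴱ e ≡ πᴱ e' →
                    _≈L_ k (proj₁ e) (proj₁ e') × proj₂ e ≡ proj₂ e'
  πᴱ-injectiveOut (g , s) (g' , s') g≈g'@(conf≗ , pos≡) eq = g≈g' , +ₖ-cancelˡ _ (+ₖ-cancelˡ _ same-last)
    where
    lampAhead : conf g (pos g + + N) ≡ conf g' (pos g' + + N)
    lampAhead = trans (conf≗ _) (cong (λ t → conf g' (t + + N)) pos≡)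
    lampHere : conf g (pos g) ≡ conf g' (pos g')
    lampHere = trans (conf≗ _) (cong (conf g') pos≡)
    same-last : conf g (pos g + + N) +ₖ (conf g (pos g) +ₖ s) ≡ conf g (pos g + + N) +ₖ (conf g (pos g) +ₖ s')
    same-last = begin
      conf g (pos g + + N) +ₖ (conf g (pos g) +ₖ s)     ≡⟨ sym (lastLetter-⋆c̄ g s) ⟩
      lastLetter (word (g ⋆ c̄ k s))                     ≡⟨ cong proj₂ eq ⟩
      lastLetter (word (g' ⋆ c̄ k s'))                   ≡⟨ lastLetter-⋆c̄ g' s' ⟩
      conf g' (pos g' + + N) +ₖ (conf g' (pos g') +ₖ s') ≡⟨ cong₂ (λ a b → a +ₖ (b +ₖ s')) (sym lampAhead) (sym lampHere) ⟩
      conf g (pos g + + N) +ₖ (conf g (pos g) +ₖ s')     ∎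

  liftOut : Lamp k → Edge → Lamp k × Fin k
  liftOut g h = g , (proj₂ h -ₖ (conf g (pos g + + N) +ₖ conf g (pos g)))

  π-liftOut : ∀ g h → OGraph.ι SW∞ h ≡ π g → πᴱ (liftOut g h) ≡ h
  π-liftOut g (v , y) eq = cong₂ _,_ (sym eq) (begin
    lastLetter (word (g ⋆ c̄ k (y -ₖ a)))                 ≡⟨ lastLetter-⋆c̄ g (y -ₖ a) ⟩
    conf g (pos g + + N) +ₖ (conf g (pos g) +ₖ (y -ₖ a)) ≡⟨ sym (+ₖ-assoc _ _ _) ⟩
    a +ₖ (y -ₖ a)                                       ≡⟨ b+[a-b]≡a y a ⟩
    y                                                   ∎)
    where a = conf g (pos g + + N) +ₖ conf g (pos g)

  b⁻¹ : Lamp k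
  b⁻¹ = lamp (λ _ → 0ₖ) ([] , λ _ _ → refl) (- + 1)

  predecessor : Lamp k → Fin k → Lamp k
  predecessor g a = (g ⋆ b⁻¹) ⋆ cⁿ (toℕ a)

  private
    pred-pos : ∀ n → (n - + 1) + + 1 ≡ n
    pred-pos = solve-∀
    succ-pred : ∀ n → (n + + 1) - + 1 ≡ n
    succ-pred = solve-∀
    pred-shift : ∀ n a → (n - + 1) + (+ 1 + a) ≡ n + a
    pred-shift = solve-∀
    pred-shift-N : ∀ n a b → (n - + 1) + (+ 1 + a) - b ≡ n + a - b
    pred-shift-N = solve-∀

  pos-predecessor : ∀ g a → pos (predecessor g a) ≡ pos g - + 1
  pos-predecessor g a = pos-⋆cⁿ (g ⋆ b⁻¹) (toℕ a)

  conf-predecessor-≢ : ∀ g a z → z ≢ pos g - + 1 → conf (predecessor g a) z ≡ conf g z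
  conf-predecessor-≢ g a z z≢ = trans (conf-⋆cⁿ-≢pos (g ⋆ b⁻¹) (toℕ a) z z≢) (+ₖ-identityʳ (conf g z))

  conf-predecessor-pos : ∀ g a → conf (predecessor g a) (pos g - + 1) ≡ conf g (pos g - + 1) +ₖ a
  conf-predecessor-pos g a = trans (conf-⋆cⁿ-pos (g ⋆ b⁻¹) (toℕ a))
                                   (cong₂ _+ₖ_ (+ₖ-identityʳ _) (toℕ-mod-fin a))

  predecessor-⋆c̄ : ∀ g a → _≈L_ k (predecessor g a ⋆ c̄ k (-ₖ a)) g
  predecessor-⋆c̄ g a = lamps , trans (pos-⋆c̄ g' (-ₖ a)) (trans (cong (_+ + 1) (pos-predecessor g a)) (pred-pos (pos g)))
    where
    g' = predecessor g a
    q = pos g - + 1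
    lamps : ∀ z → conf (g' ⋆ c̄ k (-ₖ a)) z ≡ conf g z
    lamps z with z ℤP.≟ q
    ... | yes refl = begin
      conf (g' ⋆ c̄ k (-ₖ a)) q   ≡⟨ cong (conf (g' ⋆ c̄ k (-ₖ a))) (sym (pos-predecessor g a)) ⟩
      conf (g' ⋆ c̄ k (-ₖ a)) (pos g') ≡⟨ conf-⋆c̄-pos g' (-ₖ a) ⟩
      conf g' (pos g') -ₖ a      ≡⟨ cong (λ p → conf g' p -ₖ a) (pos-predecessor g a) ⟩
      conf g' q -ₖ a             ≡⟨ cong (_-ₖ a) (conf-predecessor-pos g a) ⟩
      (conf g q +ₖ a) -ₖ a       ≡⟨ a+b-b≡a (conf g q) a ⟩
      conf g q                   ∎
    ... | no z≢q = trans (conf-⋆c̄-≢pos g' (-ₖ a) z (λ z≡ → z≢q (trans z≡ (pos-predecessor g a))))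
                         (conf-predecessor-≢ g a z z≢q)

  at-word-predecessor-0 : ∀ g a →
    at (word (predecessor g a)) 0 ≡ (conf g (pos g - + 1) +ₖ a) +ₖ conf g (pos g - + 1 - + N)
  at-word-predecessor-0 g a = begin
    at (word g') 0                                          ≡⟨ at-word g' 0 (s≤s z≤n) ⟩
    conf g' (pos g' + + 0) +ₖ conf g' (pos g' + + 0 - + N)  ≡⟨ cong (λ t → conf g' t +ₖ conf g' (t - + N)) (trans (ℤP.+-identityʳ _) (pos-predecessor g a)) ⟩
    conf g' q +ₖ conf g' (q - + N)                          ≡⟨ cong₂ _+ₖ_ (conf-predecessor-pos g a) (conf-predecessor-≢ g a _ (n-N≢n q)) ⟩
    (conf g q +ₖ a) +ₖ conf g (q - + N)                     ∎
    where
    g' = predecessor g a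
    q = pos g - + 1

  at-word-predecessor-suc : ∀ g a l → suc l < N → at (word (predecessor g a)) (suc l) ≡ at (word g) l
  at-word-predecessor-suc g a l h = begin
    at (word g') (suc l)                                            ≡⟨ at-word g' (suc l) h ⟩
    conf g' (pos g' + + suc l) +ₖ conf g' (pos g' + + suc l - + N)  ≡⟨ cong (λ t → conf g' (t + + suc l) +ₖ conf g' (t + + suc l - + N)) (pos-predecessor g a) ⟩
    conf g' (q + + suc l) +ₖ conf g' (q + + suc l - + N)
      ≡⟨ cong₂ _+ₖ_ (conf-predecessor-≢ g a _ (n+suc-l≢n q l)) (conf-predecessor-≢ g a _ (n+suc-l-N≢n q l h)) ⟩
    conf g (q + + suc l) +ₖ conf g (q + + suc l - + N)
      ≡⟨ cong₂ (λ u v → conf g u +ₖ conf g v) (pred-shift (pos g) (+ l)) (pred-shift-N (pos g) (+ l) (+ N)) ⟩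
    letter g l                                                      ≡⟨ sym (at-word g l (ℕP.<-trans (ℕP.n<1+n l) h)) ⟩
    at (word g) l                                                   ∎
    where
    g' = predecessor g a
    q = pos g - + 1

  liftIn : ∀ g h → OGraph.τ SW∞ h ≡ π g →
           Σ (Lamp k × Fin k) λ e → _≈L_ k (proj₁ e ⋆ c̄ k (proj₂ e)) g × πᴱ e ≡ h
  liftIn g ((w , m) , y) τh≡πg =
    (g' , -ₖ a) , predecessor-⋆c̄ g a , cong₂ _,_ (cong₂ _,_ word-g'≡w pos-g'≡m) last≡y
    where
    q = pos g - + 1
    a = at w 0 -ₖ (conf g q +ₖ conf g (q - + N))
    g' = predecessor g a
    shift-w≡word-g : shiftIn w y ≡ word g
    shift-w≡word-g = cong proj₁ τh≡πg
    pos-g'≡m : pos g' ≡ m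
    pos-g'≡m = begin
      pos g'           ≡⟨ pos-predecessor g a ⟩
      pos g - + 1      ≡⟨ cong (_- + 1) (sym (cong proj₂ τh≡πg)) ⟩
      (m + + 1) - + 1  ≡⟨ succ-pred m ⟩
      m                ∎
    last≡y : lastLetter (word (g' ⋆ c̄ k (-ₖ a))) ≡ y
    last≡y = begin
      at (word (g' ⋆ c̄ k (-ₖ a))) N₁  ≡⟨ cong (λ v → at (proj₁ v) N₁) (π-cong {g' ⋆ c̄ k (-ₖ a)} {g} (predecessor-⋆c̄ g a)) ⟩
      at (word g) N₁                  ≡⟨ cong (λ v → at v N₁) (sym shift-w≡word-g) ⟩
      at (shiftIn w y) N₁             ≡⟨ at-shiftIn-last w y N₁ refl ⟩
      y                               ∎
    word-g'≡w : word g' ≡ w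
    word-g'≡w = at-ext _ _ letters
      where
      letters : ∀ l → l < N → at (word g') l ≡ at w l
      letters zero _ = begin
        at (word g') 0                                   ≡⟨ at-word-predecessor-0 g a ⟩
        (conf g q +ₖ a) +ₖ conf g (q - + N)              ≡⟨ +ₖ-assoc _ _ _ ⟩
        conf g q +ₖ (a +ₖ conf g (q - + N))              ≡⟨ cong (conf g q +ₖ_) (+ₖ-comm a _) ⟩
        conf g q +ₖ (conf g (q - + N) +ₖ a)              ≡⟨ sym (+ₖ-assoc _ _ _) ⟩
        (conf g q +ₖ conf g (q - + N)) +ₖ a              ≡⟨ b+[a-b]≡a (at w 0) _ ⟩
        at w 0                                           ∎
      letters (suc l) h = begin
        at (word g') (suc l)  ≡⟨ at-word-predecessor-suc g a l h ⟩
        at (word g) l         ≡⟨ cong (λ v → at v l) (sym shift-w≡word-g) ⟩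
        at (shiftIn w y) l    ≡⟨ at-shiftIn-< w y l h ⟩
        at w (suc l)          ∎

  Confined : ℕ → Lamp k → Set
  Confined t g = (- + t ≤ pos g) × (pos g ≤ + t) × (∀ z → Outside t z → conf g z ≡ 0ₖ)

  ball⇒Confined : ∀ {t g} → InBall (CayGraph k) (Defs.e k) t g → Confined t g
  ball⇒Confined {t} (root (conf≗ , pos≡)) =
    subst (- + t ≤_) pos≡ ℤP.neg-≤-pos , subst (_≤ + t) pos≡ (0≤+ t) , λ z _ → sym (conf≗ z)
  ball⇒Confined {suc t} {g} (fwd (g₀ , s) b (conf≗ , pos≡)) with ball⇒Confined b
  ... | lo , hi , dark = subst (- + suc t ≤_) pos≡′ (-‿≤-suc lo) , subst (_≤ + suc t) pos≡′ (≤-suc hi) , dark′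
    where
    pos≡′ = trans (sym (pos-⋆c̄ g₀ s)) pos≡
    dark′ : ∀ z → Outside (suc t) z → conf g z ≡ 0ₖ
    dark′ z out = begin
      conf g z              ≡⟨ sym (conf≗ z) ⟩
      conf (g₀ ⋆ c̄ k s) z   ≡⟨ conf-⋆c̄-≢pos g₀ s z (Outside⇒≢ out (-‿≤-weaken lo) (≤-suc hi)) ⟩
      conf g₀ z             ≡⟨ dark z (Outside-suc⇒Outside out) ⟩
      0ₖ                    ∎
  ball⇒Confined {suc t} {g} (bwd (g₀ , s) b (conf≗ , pos≡)) with ball⇒Confined b
  ... | lo′ , hi′ , dark = subst (- + suc t ≤_) pos≡ (-‿≤-pred lo) , subst (_≤ + suc t) pos≡ (≤-pred hi) , dark′
    where
    lo = subst (- + t ≤_) (pos-⋆c̄ g₀ s) lo′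
    hi = subst (_≤ + t) (pos-⋆c̄ g₀ s) hi′
    dark′ : ∀ z → Outside (suc t) z → conf g z ≡ 0ₖ
    dark′ z out = begin
      conf g z              ≡⟨ sym (conf≗ z) ⟩
      conf g₀ z             ≡⟨ sym (conf-⋆c̄-≢pos g₀ s z (Outside⇒≢ out (-‿≤-pred lo) (≤-weaken hi))) ⟩
      conf (g₀ ⋆ c̄ k s) z   ≡⟨ dark z (Outside-suc⇒Outside out) ⟩
      0ₖ                    ∎

  -- Within the R-ball and for 4R ≤ N at most one of the two lamps summed in a letter is lit,
  -- so the lamps at offsets 0 … N-2R-1 from pos g are read off the first letters of the word
  -- and those at offsets -2R … -1 off its last letters.
  module Unfold (r : ℕ) where

    R : ℕ
    R = suc r

    diam : ℕ
    diam = R ℕ.+ R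

    unfold : Vec (Fin k) N → ℤ → Fin k
    unfold x (+ l) with l ℕ.<? N ∸ diam
    ... | yes _ = at x l
    ... | no  _ = 0ₖ
    unfold x -[1+ j ] with j ℕ.<? diam
    ... | yes _ = at x (N ∸ suc j)
    ... | no  _ = 0ₖ

    window : ℤ → List ℤ
    window n = map (λ l → n + + l) (upTo (N ∸ diam)) ++ map (λ j → n + -[1+ j ]) (upTo diam)

    unfold-window : ∀ x n z → z ∉ window n → unfold x (z - n) ≡ 0ₖ
    unfold-window x n z z∉ with z - n in eq
    ... | + l with l ℕ.<? N ∸ diam
    ...   | yes h = ⊥-elim (z∉ (∈-++⁺ˡ (subst (_∈ _) (trans (cong (λ t → n + t) (sym eq)) (sym (i≡j+[i-j] z n)))
                                                  (∈-map⁺ (λ l → n + + l) (∈-upTo⁺ h)))))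
    ...   | no  _ = refl
    unfold-window x n z z∉ | -[1+ j ] with j ℕ.<? diam
    ...   | yes h = ⊥-elim (z∉ (∈-++⁺ʳ _ (subst (_∈ _) (trans (cong (λ t → n + t) (sym eq)) (sym (i≡j+[i-j] z n)))
                                                   (∈-map⁺ (λ j → n + -[1+ j ]) (∈-upTo⁺ h)))))
    ...   | no  _ = refl

    section : Vertex → Lamp k
    section (x , n) = lamp (λ p → unfold x (p - n)) (window n , unfold-window x n) n

    private
      ahead-second : ∀ n l R N → - R ≡ ((n + l - N) + + 1) + ((R - n) + (N - (+ 1 + (l + (R + R)))))
      ahead-second = solve-∀
      ahead-far : ∀ n l R N → n + l ≡ R + ((n - - R) + ((l + (R + R) - N) + (N - (R + R + R + R))))
      ahead-far = solve-∀
      behind-first : ∀ n j R N → n + (N - (+ 1 + j)) ≡ R + ((n - - R) + ((R + R - (+ 1 + j)) + (N - (R + R + R + R))))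
      behind-first = solve-∀
      behind-far : ∀ n j R → - R ≡ ((n + - (+ 1 + j)) + + 1) + ((R - n) + (j - (R + R)))
      behind-far = solve-∀
      behind-second : ∀ n j N → n + (N - (+ 1 + j)) - N ≡ n + - (+ 1 + j)
      behind-second = solve-∀

    module _ (4R≤N : R ℕ.+ R ℕ.+ R ℕ.+ R ℕ.≤ N) {g : Lamp k} (conf-g : Confined R g) where
      private
        n = pos g
        lo = proj₁ conf-g
        hi = proj₁ (proj₂ conf-g)
        dark = proj₂ (proj₂ conf-g)
        4R≤Nℤ : + R + + R + + R + + R ≤ + N
        4R≤Nℤ = +≤+ 4R≤N
        diam≤N : diam ℕ.≤ N
        diam≤N = ℕP.≤-trans (ℕP.m≤m+n diam (R ℕ.+ R)) (subst (ℕ._≤ N) (ℕP.+-assoc diam R R) 4R≤N)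

      unfold-ahead : ∀ l → l ℕ.< N ∸ diam → at (word g) l ≡ conf g (n + + l)
      unfold-ahead l h = begin
        at (word g) l                               ≡⟨ at-word g l (ℕP.<-≤-trans h (ℕP.m∸n≤m N diam)) ⟩
        conf g (n + + l) +ₖ conf g (n + + l - + N)  ≡⟨ cong (conf g (n + + l) +ₖ_) (dark _ (inj₁ second-dark)) ⟩
        conf g (n + + l) +ₖ 0ₖ                      ≡⟨ +ₖ-identityʳ _ ⟩
        conf g (n + + l)                            ∎
        where
        second-dark : (n + + l - + N) + + 1 ≤ - + R
        second-dark = ≤-from-slack _ (ahead-second n (+ l) (+ R) (+ N))
          (0≤-⊕ (i≤j⇒0≤j-i hi) (i≤j⇒0≤j-i (+≤+ (ℕP.m≤o∸n⇒m+n≤o (suc l) diam≤N h))))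

      unfold-ahead-far : ∀ l → N ∸ diam ℕ.≤ l → conf g (n + + l) ≡ 0ₖ
      unfold-ahead-far l h = dark _ (inj₂ (≤-from-slack _ (ahead-far n (+ l) (+ R) (+ N))
        (0≤-⊕ (i≤j⇒0≤j-i lo) (0≤-⊕ (i≤j⇒0≤j-i (+≤+ N≤l+diam)) (i≤j⇒0≤j-i 4R≤Nℤ)))))
        where
        N≤l+diam : N ℕ.≤ l ℕ.+ diam
        N≤l+diam = subst (ℕ._≤ l ℕ.+ diam) (ℕP.m∸n+n≡m diam≤N) (ℕP.+-monoˡ-≤ diam h)

      unfold-behind : ∀ j → j ℕ.< diam → at (word g) (N ∸ suc j) ≡ conf g (n + -[1+ j ])
      unfold-behind j h = begin
        at (word g) (N ∸ suc j)                                ≡⟨ at-word g (N ∸ suc j) (s≤s (ℕP.m∸n≤m N₁ j)) ⟩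
        conf g (n + + (N ∸ suc j)) +ₖ conf g (n + + (N ∸ suc j) - + N)
          ≡⟨ cong (λ t → conf g (n + t) +ₖ conf g (n + t - + N)) N∸suc-j ⟩
        conf g (n + (+ N - (+ 1 + + j))) +ₖ conf g (n + (+ N - (+ 1 + + j)) - + N)
          ≡⟨ cong₂ _+ₖ_ (dark _ (inj₂ first-dark)) (cong (conf g) (behind-second n (+ j) (+ N))) ⟩
        0ₖ +ₖ conf g (n + -[1+ j ])                            ≡⟨ +ₖ-identityˡ _ ⟩
        conf g (n + -[1+ j ])                                  ∎
        where
        N∸suc-j : + (N ∸ suc j) ≡ + N - (+ 1 + + j)
        N∸suc-j = sym (trans (ℤP.m-n≡m⊖n N (suc j)) (ℤP.⊖-≥ (ℕP.≤-trans h diam≤N)))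
        first-dark : + R ≤ n + (+ N - (+ 1 + + j))
        first-dark = ≤-from-slack _ (behind-first n (+ j) (+ R) (+ N))
          (0≤-⊕ (i≤j⇒0≤j-i lo) (0≤-⊕ (i≤j⇒0≤j-i (+≤+ h)) (i≤j⇒0≤j-i 4R≤Nℤ)))

      unfold-behind-far : ∀ j → diam ℕ.≤ j → conf g (n + -[1+ j ]) ≡ 0ₖ
      unfold-behind-far j h = dark _ (inj₁ (≤-from-slack _ (behind-far n (+ j) (+ R))
        (0≤-⊕ (i≤j⇒0≤j-i hi) (i≤j⇒0≤j-i (+≤+ h)))))

      unfold-word : ∀ p → unfold (word g) (p - n) ≡ conf g p
      unfold-word p with p - n in eq
      ... | + l with l ℕ.<? N ∸ diam
      ...   | yes h = trans (unfold-ahead l h) (cong (conf g) (sym p≡))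
        where p≡ = trans (i≡j+[i-j] p n) (cong (λ t → n + t) eq)
      ...   | no  h = sym (trans (cong (conf g) p≡) (unfold-ahead-far l (ℕP.≮⇒≥ h)))
        where p≡ = trans (i≡j+[i-j] p n) (cong (λ t → n + t) eq)
      unfold-word p | -[1+ j ] with j ℕ.<? diam
      ...   | yes h = trans (unfold-behind j h) (cong (conf g) (sym p≡))
        where p≡ = trans (i≡j+[i-j] p n) (cong (λ t → n + t) eq)
      ...   | no  h = sym (trans (cong (conf g) p≡) (unfold-behind-far j (ℕP.≮⇒≥ h)))
        where p≡ = trans (i≡j+[i-j] p n) (cong (λ t → n + t) eq)

    module _ (4R≤N : R ℕ.+ R ℕ.+ R ℕ.+ R ℕ.≤ N) where

      section-π : ∀ g → InBall (CayGraph k) (Defs.e k) R g → _≈L_ k (section (π g)) g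
      section-π g b = unfold-word 4R≤N {g} (ball⇒Confined b) , refl

      open Balls.Covering (CayGraph k) Vertex Edge (OGraph.ι SW∞) (OGraph.τ SW∞)
                          (Defs.e k) (replicate N 0ₖ , 0ℤ) r

      π-root : π (Defs.e k) ≡ (replicate N 0ₖ , 0ℤ)
      π-root = cong (_, 0ℤ) (at-ext _ _ (λ l h → trans (at-word (Defs.e k) l h) (trans 0+0 (sym (at-replicate N l)))))

      covering : Covering
      covering = record
        { π = π ; πᴱ = πᴱ
        ; π-cong  = λ {g} {h} → π-cong {g} {h}
        ; πᴱ-cong = λ { {g , s} {g' , s'} (g≈g' , refl) →
                        cong₂ _,_ (π-cong {g} {g'} g≈g')
                              (cong (λ v → lastLetter (proj₁ v))
                                    (π-cong {g ⋆ c̄ k s} {g' ⋆ c̄ k s} (OGraph.τ-cong (CayGraph k) {g , s} {g' , s} (g≈g' , refl)))) }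
        ; π-ι = λ _ → refl
        ; π-τ = π-τ
        ; liftOut   = liftOut
        ; liftOut-ι = λ _ _ _ → (λ _ → refl) , refl
        ; π-liftOut = π-liftOut
        ; liftIn    = liftIn
        ; πᴱ-injectiveOut = πᴱ-injectiveOut
        ; section   = section
        ; section-π = section-π
        ; π-root    = π-root
        }

      Cay≅SW∞ : BallIso r (CayRooted k) (SWinfRooted k N)
      Cay≅SW∞ = covering⇒BallIso covering

module Clock (M' : ℕ) where

  open import Data.Nat using (_+_; _<_; s≤s)
  import Data.Nat.Properties as ℕP
  open import Data.Nat.DivMod using (_%_; n%n≡0; m<n⇒m%n≡m)
  open import Data.Fin using (fromℕ; inject₁)
  open import Data.Fin.Properties using (toℕ-injective; toℕ-fromℕ; toℕ-inject₁; toℕ<n)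
  open import Data.Integer using (ℤ; +_; -[1+_]) renaming (_+_ to _⊕_)
  import Data.Integer.Properties as ℤP
  open ≡-Reasoning

  M : ℕ
  M = suc M'

  open ModularArithmetic {M}

  succ : Fin M → Fin M
  succ i = (toℕ i + 1) mod M

  pred : Fin M → Fin M
  pred Fin.zero    = fromℕ M'
  pred (Fin.suc j) = inject₁ j

  succ-pred : ∀ i → succ (pred i) ≡ i
  succ-pred Fin.zero = toℕ-injective (begin
    toℕ (succ (fromℕ M'))       ≡⟨ toℕ-mod (toℕ (fromℕ M') + 1) ⟩
    (toℕ (fromℕ M') + 1) % M    ≡⟨ cong (λ t → (t + 1) % M) (toℕ-fromℕ M') ⟩
    (M' + 1) % M                ≡⟨ cong (_% M) (ℕP.+-comm M' 1) ⟩
    M % M                       ≡⟨ n%n≡0 M ⟩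
    0                           ∎)
  succ-pred (Fin.suc j) = toℕ-injective (begin
    toℕ (succ (inject₁ j))      ≡⟨ toℕ-mod (toℕ (inject₁ j) + 1) ⟩
    (toℕ (inject₁ j) + 1) % M   ≡⟨ cong (λ t → (t + 1) % M) (toℕ-inject₁ j) ⟩
    (toℕ j + 1) % M             ≡⟨ cong (_% M) (ℕP.+-comm (toℕ j) 1) ⟩
    suc (toℕ j) % M             ≡⟨ m<n⇒m%n≡m (s≤s (toℕ<n j)) ⟩
    suc (toℕ j)                 ∎)

  succ≡+1 : ∀ i → succ i ≡ i +ₖ (1 mod M)
  succ≡+1 i = toℕ-injective (begin
    toℕ (succ i)                   ≡⟨ toℕ-mod (toℕ i + 1) ⟩
    (toℕ i + 1) % M                ≡⟨ sym ([m+n%k]%k≡[m+n]%k (toℕ i) 1) ⟩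
    (toℕ i + 1 % M) % M            ≡⟨ cong (λ t → (toℕ i + t) % M) (sym (toℕ-mod 1)) ⟩
    (toℕ i + toℕ (1 mod M)) % M    ≡⟨ sym (toℕ-+ₖ i (1 mod M)) ⟩
    toℕ (i +ₖ (1 mod M))           ∎)

  succ-injective : ∀ {a b} → succ a ≡ succ b → a ≡ b
  succ-injective {a} {b} eq = +ₖ-cancelʳ (1 mod M) (trans (sym (succ≡+1 a)) (trans eq (succ≡+1 b)))

  succ^ : ℕ → Fin M → Fin M
  succ^ zero    i = i
  succ^ (suc n) i = succ (succ^ n i)

  pred^ : ℕ → Fin M → Fin M
  pred^ zero    i = i
  pred^ (suc n) i = pred (pred^ n i)

  mod-suc : ∀ n → (n mod M) +ₖ (1 mod M) ≡ suc n mod M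
  mod-suc n = toℕ-injective (begin
    toℕ ((n mod M) +ₖ (1 mod M))        ≡⟨ toℕ-+ₖ (n mod M) (1 mod M) ⟩
    (toℕ (n mod M) + toℕ (1 mod M)) % M ≡⟨ cong₂ (λ a b → (a + b) % M) (toℕ-mod n) (toℕ-mod 1) ⟩
    (n % M + 1 % M) % M                 ≡⟨ [m+n%k]%k≡[m+n]%k (n % M) 1 ⟩
    (n % M + 1) % M                     ≡⟨ [m%k+n]%k≡[m+n]%k n 1 ⟩
    (n + 1) % M                         ≡⟨ cong (_% M) (ℕP.+-comm n 1) ⟩
    suc n % M                           ≡⟨ sym (toℕ-mod (suc n)) ⟩
    toℕ (suc n mod M)                   ∎)

  succ^≡+ : ∀ n i → succ^ n i ≡ i +ₖ (n mod M)
  succ^≡+ zero    i = sym (trans (cong (i +ₖ_) (toℕ-mod-fin Fin.zero)) (+ₖ-identityʳ i))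
  succ^≡+ (suc n) i = begin
    succ (succ^ n i)                   ≡⟨ cong succ (succ^≡+ n i) ⟩
    succ (i +ₖ (n mod M))              ≡⟨ succ≡+1 (i +ₖ (n mod M)) ⟩
    (i +ₖ (n mod M)) +ₖ (1 mod M)      ≡⟨ +ₖ-assoc i _ _ ⟩
    i +ₖ ((n mod M) +ₖ (1 mod M))      ≡⟨ cong (i +ₖ_) (mod-suc n) ⟩
    i +ₖ (suc n mod M)                 ∎

  succ^-injective : ∀ {a b} i → a < M → b < M → succ^ a i ≡ succ^ b i → a ≡ b
  succ^-injective {a} {b} i a<M b<M eq = begin
    a                ≡⟨ sym (m<n⇒m%n≡m a<M) ⟩
    a % M            ≡⟨ sym (toℕ-mod a) ⟩
    toℕ (a mod M)    ≡⟨ cong toℕ (+ₖ-cancelˡ i (trans (sym (succ^≡+ a i)) (trans eq (succ^≡+ b i)))) ⟩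
    toℕ (b mod M)    ≡⟨ toℕ-mod b ⟩
    b % M            ≡⟨ m<n⇒m%n≡m b<M ⟩
    b                ∎

  height : Fin M → ℤ → Fin M
  height i₀ (+ n)    = succ^ n i₀
  height i₀ -[1+ n ] = pred^ (suc n) i₀

  height-suc : ∀ i₀ d → height i₀ (d ⊕ + 1) ≡ succ (height i₀ d)
  height-suc i₀ (+ n) = cong (λ m → succ^ m i₀) (ℕP.+-comm n 1)
  height-suc i₀ -[1+ zero ]  = sym (succ-pred i₀)
  height-suc i₀ -[1+ suc n ] = sym (succ-pred (pred^ (suc n) i₀))

  height-+ : ∀ i₀ d a → height i₀ (d ⊕ + a) ≡ succ^ a (height i₀ d)
  height-+ i₀ d zero    = cong (height i₀) (ℤP.+-identityʳ d)
  height-+ i₀ d (suc a) = begin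
    height i₀ (d ⊕ + suc a)          ≡⟨ cong (λ t → height i₀ (d ⊕ + t)) (ℕP.+-comm 1 a) ⟩
    height i₀ (d ⊕ (+ a ⊕ + 1))      ≡⟨ cong (height i₀) (sym (ℤP.+-assoc d (+ a) (+ 1))) ⟩
    height i₀ ((d ⊕ + a) ⊕ + 1)      ≡⟨ height-suc i₀ (d ⊕ + a) ⟩
    succ (height i₀ (d ⊕ + a))       ≡⟨ cong succ (height-+ i₀ d a) ⟩
    succ (succ^ a (height i₀ d))     ∎

-- A word that has period p on the Lc + p positions starting at A is determined by p and by
-- the word with those Lc positions deleted: the deleted letters are copies.
module PeriodicWords {k : ℕ} .{{_ : NonZero k}} (N Lc A : ℕ) where

  open import Data.Nat using (_+_; _∸_; _<_; _≤_; _<?_; s≤s; z≤n)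
  import Data.Nat.Properties as ℕP
  open import Data.Nat.DivMod using (_%_; m<n⇒m%n≡m; [m+n]%n≡m%n; m%n<n)
  open import Data.List using (List; cartesianProductWith; upTo)
  open import Data.List.Membership.Propositional using (_∈_)
  open import Data.List.Membership.Propositional.Properties using (∈-upTo⁺; ∈-cartesianProductWith⁺)
  open import Data.Empty using (⊥-elim)
  open import Relation.Nullary using (yes; no)
  open Words (0ₖ {k})
  open ≡-Reasoning

  Periodic : ℕ → Vec (Fin k) N → Set
  Periodic p w = ∀ s → s < Lc → at w (A + s) ≡ at w (A + s + suc p)

  periodic-mod : ∀ p w → Periodic p w → ∀ s → s < suc p + Lc → at w (A + s) ≡ at w (A + s % suc p)
  periodic-mod p w per s = go s s (ℕP.n<1+n s)
    where
    go : ∀ fuel s → s < suc fuel → s < suc p + Lc → at w (A + s) ≡ at w (A + s % suc p)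
    go fuel s s<fuel s<bound with s <? suc p
    ... | yes s<p = cong (λ t → at w (A + t)) (sym (m<n⇒m%n≡m s<p))
    go (suc fuel) s s<fuel s<bound | no s≮p = begin
      at w (A + s)                      ≡⟨ cong (λ t → at w (A + t)) (sym s′+p≡s) ⟩
      at w (A + (s′ + suc p))           ≡⟨ cong (at w) (sym (ℕP.+-assoc A s′ (suc p))) ⟩
      at w (A + s′ + suc p)             ≡⟨ sym (per s′ s′<Lc) ⟩
      at w (A + s′)                     ≡⟨ go fuel s′ s′<fuel (ℕP.<-trans s′<Lc (ℕP.m<n+m Lc (s≤s z≤n))) ⟩
      at w (A + s′ % suc p)             ≡⟨ cong (λ t → at w (A + t)) (sym ([m+n]%n≡m%n s′ (suc p))) ⟩
      at w (A + (s′ + suc p) % suc p)   ≡⟨ cong (λ t → at w (A + t % suc p)) s′+p≡s ⟩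
      at w (A + s % suc p)              ∎
      where
      s′ = s ∸ suc p
      s′+p≡s : s′ + suc p ≡ s
      s′+p≡s = ℕP.m∸n+n≡m (ℕP.≮⇒≥ s≮p)
      s′<Lc : s′ < Lc
      s′<Lc = ℕP.+-cancelʳ-< (suc p) s′ Lc (subst (_< Lc + suc p) (sym s′+p≡s) (subst (s <_) (ℕP.+-comm (suc p) Lc) s<bound))
      s′<fuel : s′ < suc fuel
      s′<fuel = ℕP.≤-trans (subst (suc s′ ≤_) s′+p≡s (subst (_≤ s′ + suc p) (ℕP.+-comm s′ 1) (ℕP.+-monoʳ-≤ s′ (s≤s z≤n))))
                           (ℕP.≤-pred s<fuel)
    go zero s (s≤s z≤n) s<bound | no s≮p = ⊥-elim (s≮p (s≤s z≤n))

  source : ℕ → ℕ → ℕ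
  source p q with q <? A
  ... | yes _ = q
  ... | no  _ with q <? A + suc p + Lc
  ...   | yes _ = A + (q ∸ A) % suc p
  ...   | no  _ = q ∸ Lc

  expand : ℕ → Vec (Fin k) (N ∸ Lc) → Vec (Fin k) N
  expand p u = tab N (λ q → at u (source p q))

  shortLetter : ℕ → Vec (Fin k) N → ℕ → Fin k
  shortLetter p w j with j <? A + suc p
  ... | yes _ = at w j
  ... | no  _ = at w (j + Lc)

  compress : ℕ → Vec (Fin k) N → Vec (Fin k) (N ∸ Lc)
  compress p w = tab (N ∸ Lc) (shortLetter p w)

  module _ (p : ℕ) (w : Vec (Fin k) N) (per : Periodic p w) (fits : A + suc p + Lc ≤ N) where

    private
      N∸Lc+Lc≡N : N ∸ Lc + Lc ≡ N
      N∸Lc+Lc≡N = ℕP.m∸n+n≡m (ℕP.≤-trans (ℕP.m≤n+m Lc (A + suc p)) fits)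

      <N∸Lc : ∀ j → j + Lc < N → j < N ∸ Lc
      <N∸Lc j h = ℕP.+-cancelʳ-< Lc j (N ∸ Lc) (subst (j + Lc <_) (sym N∸Lc+Lc≡N) h)

      shortLetter-< : ∀ j → j < A + suc p → at (compress p w) j ≡ at w j
      shortLetter-< j h = trans (at-tab (N ∸ Lc) (shortLetter p w) j (<N∸Lc j (ℕP.<-≤-trans (ℕP.+-monoˡ-< Lc h) fits))) letter
        where
        letter : shortLetter p w j ≡ at w j
        letter with j <? A + suc p
        ... | yes _ = refl
        ... | no  ¬h = ⊥-elim (¬h h)

    at-compress-source : ∀ q → q < N → at (compress p w) (source p q) ≡ at w q
    at-compress-source q q<N with q <? A
    ... | yes q<A = shortLetter-< q (ℕP.<-≤-trans q<A (ℕP.m≤m+n A (suc p)))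
    ... | no q≮A with q <? A + suc p + Lc
    ...   | yes q<B = begin
      at (compress p w) (A + (q ∸ A) % suc p)  ≡⟨ shortLetter-< _ (ℕP.+-monoʳ-< A (m%n<n (q ∸ A) (suc p))) ⟩
      at w (A + (q ∸ A) % suc p)               ≡⟨ sym (periodic-mod p w per (q ∸ A) q∸A<) ⟩
      at w (A + (q ∸ A))                       ≡⟨ cong (at w) A+[q∸A]≡q ⟩
      at w q                                   ∎
      where
      A+[q∸A]≡q = ℕP.m+[n∸m]≡n (ℕP.≮⇒≥ q≮A)
      q∸A< : q ∸ A < suc p + Lc
      q∸A< = ℕP.+-cancelˡ-< A (q ∸ A) (suc p + Lc)
        (subst (_< A + (suc p + Lc)) (sym A+[q∸A]≡q) (subst (q <_) (ℕP.+-assoc A (suc p) Lc) q<B))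
    ...   | no q≮B = trans (at-tab (N ∸ Lc) (shortLetter p w) (q ∸ Lc) (<N∸Lc (q ∸ Lc) (subst (_< N) (sym q∸Lc+Lc≡q) q<N))) letter
      where
      q∸Lc+Lc≡q : q ∸ Lc + Lc ≡ q
      q∸Lc+Lc≡q = ℕP.m∸n+n≡m (ℕP.≤-trans (ℕP.m≤n+m Lc (A + suc p)) (ℕP.≮⇒≥ q≮B))
      letter : shortLetter p w (q ∸ Lc) ≡ at w q
      letter with q ∸ Lc <? A + suc p
      ... | yes h = ⊥-elim (q≮B (subst (_< A + suc p + Lc) q∸Lc+Lc≡q (ℕP.+-monoˡ-< Lc h)))
      ... | no  _ = cong (at w) q∸Lc+Lc≡q

    expand-compress : expand p (compress p w) ≡ w
    expand-compress = at-ext _ _ λ q q<N → trans (at-tab N _ q q<N) (at-compress-source q q<N)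

  candidates : ℕ → List (Vec (Fin k) N)
  candidates P = cartesianProductWith expand (upTo P) (allVecs k (N ∸ Lc))

  periodic∈candidates : ∀ P p w → p < P → Periodic p w → A + suc p + Lc ≤ N → w ∈ candidates P
  periodic∈candidates P p w p<P per fits = subst (_∈ candidates P) (expand-compress p w per fits)
    (∈-cartesianProductWith⁺ expand (∈-upTo⁺ p<P) (allVecs-complete (compress p w)))

-- SW_{k,N,∞} covers SW_{k,N,M} by adding to each word the matching stretch of w₀ written on
-- an otherwise blank line (ŵ₀), and reducing the ℤ-coordinate modulo M.
module WrapCovering {k : ℕ} .{{_ : NonZero k}} (N M' : ℕ) (w₀ : Vec (Fin k) N) (i₀ : Fin (suc M')) where

  open ModularArithmetic {k}
  open Words (0ₖ {k})
  open Clock M'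
  open import Data.Nat as ℕ using (_<_; _∸_; s≤s; z≤n)
  import Data.Fin as Fin
  open import Data.List using (List; map; upTo)
  open import Data.List.Membership.Propositional using (_∈_; find; lose)
  open import Data.List.Membership.Propositional.Properties using (∈-upTo⁺; ∈-upTo⁻; ∈-map⁺; ∈-map⁻)
  open import Data.List.Relation.Unary.All as All using (All; all?)
  open import Data.List.Relation.Unary.Any using (Any; any?)
  open import Data.Nat.Tactic.RingSolver as ℕS using ()
  open import Relation.Binary using (tri<; tri≈; tri>)
  open import Relation.Nullary using (Dec; yes; no; ¬?)
  open import Relation.Nullary.Decidable using (_×-dec_; decidable-stable)
  open import Relation.Unary using (Decidable)
  import Data.Nat.Properties as ℕP
  open import Data.Integer using (ℤ; +_; -[1+_]; 0ℤ; _+_; _-_; -_; _≤_; +≤+; ∣_∣)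
  import Data.Integer.Properties as ℤP
  open import Data.Integer.Tactic.RingSolver using (solve-∀)
  open import Data.Vec using (replicate)
  open import Data.Product using (Σ; _×_; _,_; proj₁; proj₂)
  open import Data.Sum using (_⊎_; inj₁; inj₂)
  open import Data.Empty using (⊥-elim)
  open LinearArithmetic
  open ≡-Reasoning

  SW∞ SWₘ : OGraph
  SW∞ = SWinfGraph k N
  SWₘ = SWfinGraph k N M'

  V∞ Vₘ : Set
  V∞ = Vec (Fin k) N × ℤ
  Vₘ = Vec (Fin k) N × Fin M

  Eₘ : Set
  Eₘ = Vₘ × Fin k

  ŵ₀ : ℤ → Fin k
  ŵ₀ (+ m)    = at w₀ m
  ŵ₀ -[1+ _ ] = 0ₖ

  stamp : Vec (Fin k) N → ℤ → ℕ → Fin k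
  stamp x d l = at x l +ₖ ŵ₀ (d + + l)

  π : V∞ → Vₘ
  π (x , d) = tab N (stamp x d) , height i₀ d

  πᴱ : V∞ × Fin k → Eₘ
  πᴱ ((x , d) , y) = π (x , d) , (y +ₖ ŵ₀ (d + + N))

  private
    shift-pos : ∀ n a → (n + + 1) + a ≡ n + (+ 1 + a)
    shift-pos = solve-∀
    pred-pos : ∀ d → (d - + 1) + + 1 ≡ d
    pred-pos = solve-∀
    pred-shift : ∀ d a → (d - + 1) + (+ 1 + a) ≡ d + a
    pred-shift = solve-∀

  π-τ : ∀ e → OGraph.τ SWₘ (πᴱ e) ≡ π (OGraph.τ SW∞ e)
  π-τ ((x , d) , y) = cong₂ _,_ (at-ext _ _ letters) (sym (height-suc i₀ d))
    where
    last = y +ₖ ŵ₀ (d + + N)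
    letters : ∀ l → l < N → at (shiftIn (tab N (stamp x d)) last) l ≡ at (tab N (stamp (shiftIn x y) (d + + 1))) l
    letters l h with ℕP.m≤n⇒m<n∨m≡n h
    ... | inj₁ sl<N = begin
      at (shiftIn (tab N (stamp x d)) last) l       ≡⟨ at-shiftIn-< (tab N (stamp x d)) last l sl<N ⟩
      at (tab N (stamp x d)) (suc l)                ≡⟨ at-tab N (stamp x d) (suc l) sl<N ⟩
      at x (suc l) +ₖ ŵ₀ (d + + suc l)              ≡⟨ cong₂ _+ₖ_ (sym (at-shiftIn-< x y l sl<N)) (cong ŵ₀ (sym (shift-pos d (+ l)))) ⟩
      stamp (shiftIn x y) (d + + 1) l               ≡⟨ sym (at-tab N _ l h) ⟩
      at (tab N (stamp (shiftIn x y) (d + + 1))) l  ∎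
    ... | inj₂ sl≡N = begin
      at (shiftIn (tab N (stamp x d)) last) l       ≡⟨ at-shiftIn-last (tab N (stamp x d)) last l sl≡N ⟩
      y +ₖ ŵ₀ (d + + N)                             ≡⟨ cong₂ _+ₖ_ (sym (at-shiftIn-last x y l sl≡N))
                                                              (cong ŵ₀ (trans (cong (λ t → d + + t) (sym sl≡N)) (sym (shift-pos d (+ l))))) ⟩
      stamp (shiftIn x y) (d + + 1) l               ≡⟨ sym (at-tab N _ l h) ⟩
      at (tab N (stamp (shiftIn x y) (d + + 1))) l  ∎

  liftOut : V∞ → Eₘ → V∞ × Fin k
  liftOut (x , d) h = (x , d) , (proj₂ h -ₖ ŵ₀ (d + + N))

  π-liftOut : ∀ v h → OGraph.ι SWₘ h ≡ π v → πᴱ (liftOut v h) ≡ h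
  π-liftOut (x , d) (v , y) eq = cong₂ _,_ (sym eq) (a-b+b≡a y _)

  πᴱ-injectiveOut : ∀ e e' → proj₁ e ≡ proj₁ e' → πᴱ e ≡ πᴱ e' → e ≡ e'
  πᴱ-injectiveOut ((x , d) , y) (.(x , d) , y') refl eq = cong ((x , d) ,_) (+ₖ-cancelʳ _ (cong proj₂ eq))

  liftIn : ∀ v h → OGraph.τ SWₘ h ≡ π v → Σ (V∞ × Fin k) λ e → OGraph.τ SW∞ e ≡ v × πᴱ e ≡ h
  liftIn (x , d) ((w , i) , y) τh≡πv =
    ((w′ , d - + 1) , y′) , cong₂ _,_ shift-w′≡x (pred-pos d) , cong₂ _,_ (cong₂ _,_ stamp-w′≡w height≡i) (a-b+b≡a y _)
    where
    shift-w≡stamp-x : shiftIn w y ≡ tab N (stamp x d)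
    shift-w≡stamp-x = cong proj₁ τh≡πv
    w′ = tab N (λ l → at w l -ₖ ŵ₀ ((d - + 1) + + l))
    y′ = y -ₖ ŵ₀ ((d - + 1) + + N)
    unstamp : ∀ l → l < N → at (shiftIn w y) l -ₖ ŵ₀ (d + + l) ≡ at x l
    unstamp l h = begin
      at (shiftIn w y) l -ₖ ŵ₀ (d + + l)           ≡⟨ cong (λ v → at v l -ₖ ŵ₀ (d + + l)) shift-w≡stamp-x ⟩
      at (tab N (stamp x d)) l -ₖ ŵ₀ (d + + l)     ≡⟨ cong (_-ₖ ŵ₀ (d + + l)) (at-tab N (stamp x d) l h) ⟩
      (at x l +ₖ ŵ₀ (d + + l)) -ₖ ŵ₀ (d + + l)     ≡⟨ a+b-b≡a _ _ ⟩
      at x l                                       ∎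
    shift-w′≡x : shiftIn w′ y′ ≡ x
    shift-w′≡x = at-ext _ _ letters
      where
      letters : ∀ l → l < N → at (shiftIn w′ y′) l ≡ at x l
      letters l h with ℕP.m≤n⇒m<n∨m≡n h
      ... | inj₁ sl<N = begin
        at (shiftIn w′ y′) l                            ≡⟨ at-shiftIn-< w′ y′ l sl<N ⟩
        at w′ (suc l)                                   ≡⟨ at-tab N _ (suc l) sl<N ⟩
        at w (suc l) -ₖ ŵ₀ ((d - + 1) + + suc l)        ≡⟨ cong₂ _-ₖ_ (sym (at-shiftIn-< w y l sl<N)) (cong ŵ₀ (pred-shift d (+ l))) ⟩
        at (shiftIn w y) l -ₖ ŵ₀ (d + + l)              ≡⟨ unstamp l h ⟩
        at x l                                          ∎
      ... | inj₂ sl≡N = begin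
        at (shiftIn w′ y′) l                            ≡⟨ at-shiftIn-last w′ y′ l sl≡N ⟩
        y -ₖ ŵ₀ ((d - + 1) + + N)                       ≡⟨ cong₂ _-ₖ_ (sym (at-shiftIn-last w y l sl≡N))
                                                                  (cong ŵ₀ (trans (cong (λ t → (d - + 1) + + t) (sym sl≡N)) (pred-shift d (+ l)))) ⟩
        at (shiftIn w y) l -ₖ ŵ₀ (d + + l)              ≡⟨ unstamp l h ⟩
        at x l                                          ∎
    stamp-w′≡w : tab N (stamp w′ (d - + 1)) ≡ w
    stamp-w′≡w = at-ext _ _ (λ l h →
      trans (at-tab N _ l h) (trans (cong (_+ₖ ŵ₀ ((d - + 1) + + l)) (at-tab N _ l h)) (a-b+b≡a (at w l) _)))
    height≡i : height i₀ (d - + 1) ≡ i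
    height≡i = succ-injective (trans (sym (height-suc i₀ (d - + 1)))
                              (trans (cong (height i₀) (pred-pos d)) (sym (cong proj₂ τh≡πv))))

  -- The offsets d ∈ [-R, R] reachable within the R-ball, and the window of letters that the
  -- R-ball of SW_{k,N,∞} leaves blank; a vertex of the R-ball of SW_{k,N,M} is unwrapped by
  -- finding an offset whose height and stamped window it matches, which is unambiguous when
  -- w₀ is Separated.
  module Unwrap (r : ℕ) where

    R : ℕ
    R = suc r

    diam : ℕ
    diam = R ℕ.+ R

    offsets : List ℤ
    offsets = map (λ a → + a - + R) (upTo (suc diam))

    window : List ℕ
    window = map (diam ℕ.+_) (upTo (N ∸ (diam ℕ.+ diam)))

    Matches : Vec (Fin k) N → ℤ → Set
    Matches x d = All (λ l → at x l ≡ ŵ₀ (d + + l)) window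

    Fits : Vec (Fin k) N → Fin M → ℤ → Set
    Fits x i d = height i₀ d ≡ i × Matches x d

    fits? : ∀ x i → Decidable (Fits x i)
    fits? x i d = (height i₀ d Fin.≟ i) ×-dec all? (λ l → at x l Fin.≟ ŵ₀ (d + + l)) window

    chosenOffset : Vec (Fin k) N → Fin M → ℤ
    chosenOffset x i with any? (fits? x i) offsets
    ... | yes p = proj₁ (find p)
    ... | no  _ = 0ℤ

    chosenOffset-fits : ∀ x i → Any (Fits x i) offsets →
                        chosenOffset x i ∈ offsets × Fits x i (chosenOffset x i)
    chosenOffset-fits x i p with any? (fits? x i) offsets
    ... | yes q = proj₂ (find q)
    ... | no ¬q = ⊥-elim (¬q p)

    Separated : Set
    Separated = ∀ d d' → d ∈ offsets → d' ∈ offsets → height i₀ d ≡ height i₀ d' →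
                All (λ l → ŵ₀ (d + + l) ≡ ŵ₀ (d' + + l)) window → d ≡ d'

    section : Vₘ → V∞
    section (x , i) = tab N (λ l → at x l -ₖ ŵ₀ (d + + l)) , d
      where d = chosenOffset x i

    Quiet : ℕ → V∞ → Set
    Quiet t (x , d) = (- + t ≤ d) × (d ≤ + t) × (∀ l → + t ≤ d + + l → d + + l + + t + + 1 ≤ + N → at x l ≡ 0ₖ)

    private
      fwd-lo : ∀ d l t → d + (+ 1 + l) ≡ t + ((((d + + 1) + l) - (+ 1 + t)) + + 1)
      fwd-lo = solve-∀
      fwd-hi : ∀ d l t n → n ≡ (d + (+ 1 + l) + t + + 1) + ((n - ((d + + 1) + l + (+ 1 + t) + + 1)) + + 1)
      fwd-hi = solve-∀
      fwd-len : ∀ d l t n → n ≡ (+ 1 + (+ 1 + l)) + ((n - ((d + + 1) + l + (+ 1 + t) + + 1)) + ((d - - t) + + 1))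
      fwd-len = solve-∀
      bwd-gap : ∀ d t → ((d + + 0) - (+ 1 + t)) + (t - (d + + 1)) ≡ - (+ 2)
      bwd-gap = solve-∀
      bwd-lo : ∀ d l t → (d + + 1) + l ≡ t + (((d + (+ 1 + l)) - (+ 1 + t)) + + 1)
      bwd-lo = solve-∀
      bwd-hi : ∀ d l t n → n ≡ ((d + + 1) + l + t + + 1) + ((n - (d + (+ 1 + l) + (+ 1 + t) + + 1)) + + 1)
      bwd-hi = solve-∀
      bwd-len : ∀ d l t n → n ≡ (+ 1 + (+ 1 + l)) + ((n - (d + (+ 1 + l) + (+ 1 + t) + + 1)) + ((d + + 1) - - t))
      bwd-len = solve-∀

    ball⇒Quiet : ∀ {t v} → InBall SW∞ (replicate N 0ₖ , 0ℤ) t v → Quiet t v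
    ball⇒Quiet {t} (root refl) = ℤP.neg-≤-pos , 0≤+ t , λ l _ _ → at-replicate N l
    ball⇒Quiet {suc t} (fwd ((x₀ , d₀) , y) b refl) with ball⇒Quiet b
    ... | lo , hi , blank = -‿≤-suc lo , ≤-suc hi , blank′
      where
      blank′ : ∀ l → + suc t ≤ (d₀ + + 1) + + l → (d₀ + + 1) + + l + + suc t + + 1 ≤ + N → at (shiftIn x₀ y) l ≡ 0ₖ
      blank′ l a₁ a₂ = trans (at-shiftIn-< x₀ y l sl<N)
        (blank (suc l) (≤-from-slack _ (fwd-lo d₀ (+ l) (+ t)) (0≤-⊕ (i≤j⇒0≤j-i a₁) (0≤+ 1)))
                       (≤-from-slack _ (fwd-hi d₀ (+ l) (+ t) (+ N)) (0≤-⊕ (i≤j⇒0≤j-i a₂) (0≤+ 1))))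
        where
        sl<N : suc l < N
        sl<N = ℤP.drop‿+≤+ (≤-from-slack _ (fwd-len d₀ (+ l) (+ t) (+ N)) (0≤-⊕ (i≤j⇒0≤j-i a₂) (0≤-⊕ (i≤j⇒0≤j-i lo) (0≤+ 1))))
    ball⇒Quiet {suc t} (bwd ((x₀ , d₀) , y) b refl) with ball⇒Quiet b
    ... | lo , hi , blank = -‿≤-pred lo , ≤-pred hi , blank′
      where
      blank′ : ∀ l → + suc t ≤ d₀ + + l → d₀ + + l + + suc t + + 1 ≤ + N → at x₀ l ≡ 0ₖ
      blank′ zero    a₁ a₂ = ⊥-elim (0≰-[1+n] (subst (0ℤ ≤_) (bwd-gap d₀ (+ t)) (0≤-⊕ (i≤j⇒0≤j-i a₁) (i≤j⇒0≤j-i hi))))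
      blank′ (suc l) a₁ a₂ = trans (sym (at-shiftIn-< x₀ y l sl<N))
        (blank l (≤-from-slack _ (bwd-lo d₀ (+ l) (+ t)) (0≤-⊕ (i≤j⇒0≤j-i a₁) (0≤+ 1)))
                 (≤-from-slack _ (bwd-hi d₀ (+ l) (+ t) (+ N)) (0≤-⊕ (i≤j⇒0≤j-i a₂) (0≤+ 1))))
        where
        sl<N : suc l < N
        sl<N = ℤP.drop‿+≤+ (≤-from-slack _ (bwd-len d₀ (+ l) (+ t) (+ N)) (0≤-⊕ (i≤j⇒0≤j-i a₂) (i≤j⇒0≤j-i lo)))

    private
      window-lo : ∀ d R t → d + (R + R + t) ≡ R + ((d - - R) + t)
      window-lo = solve-∀
      window-hi : ∀ d R t n → n ≡ (d + (R + R + t) + R + + 1) + ((R - d) + (n - (+ 1 + (t + (R + R + (R + R))))))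
      window-hi = solve-∀
      shift-back : ∀ d R → (d + R) - R ≡ d
      shift-back = solve-∀
      offset-bound : ∀ d R → R + R ≡ (d + R) + (R - d)
      offset-bound = solve-∀

      <∸⇒+< : ∀ {l} m a → l < m ∸ a → l ℕ.+ a < m
      <∸⇒+< {l} m zero    h = subst (_< m) (sym (ℕP.+-identityʳ l)) h
      <∸⇒+< zero (suc a) ()
      <∸⇒+< {l} (suc m) (suc a) h = subst (_< suc m) (sym (ℕP.+-suc l a)) (s≤s (<∸⇒+< m a h))

    ∈-offsets : ∀ d → - + R ≤ d → d ≤ + R → d ∈ offsets
    ∈-offsets d lo hi = subst (_∈ offsets) a-R≡d (∈-map⁺ (λ a → + a - + R) (∈-upTo⁺ (s≤s (ℤP.drop‿+≤+ a≤diam))))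
      where
      a = ∣ d + + R ∣
      a≡d+R : + a ≡ d + + R
      a≡d+R = ℤP.0≤i⇒+∣i∣≡i (subst (λ z → 0ℤ ≤ d + z) (ℤP.neg-involutive (+ R)) (i≤j⇒0≤j-i lo))
      a-R≡d : + a - + R ≡ d
      a-R≡d = trans (cong (_- + R) a≡d+R) (shift-back d (+ R))
      a≤diam : + a ≤ + R + + R
      a≤diam = subst (_≤ + R + + R) (sym a≡d+R) (≤-from-slack _ (offset-bound d (+ R)) (i≤j⇒0≤j-i hi))

    window-blank : ∀ {l} d → - + R ≤ d → d ≤ + R → l ∈ window →
                   (+ R ≤ d + + l) × (d + + l + + R + + 1 ≤ + N) × l < N
    window-blank {l} d lo hi l∈ with ∈-map⁻ (diam ℕ.+_) l∈
    ... | t , t∈ , refl =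
        ≤-from-slack _ (window-lo d (+ R) (+ t)) (0≤-⊕ (i≤j⇒0≤j-i lo) (0≤+ t))
      , ≤-from-slack _ (window-hi d (+ R) (+ t) (+ N)) (0≤-⊕ (i≤j⇒0≤j-i hi) (i≤j⇒0≤j-i (+≤+ t+2diam<N)))
      , ℕP.<-≤-trans (s≤s (subst (ℕ._≤ t ℕ.+ (diam ℕ.+ diam)) (ℕP.+-comm t diam) (ℕP.+-monoʳ-≤ t (ℕP.m≤m+n diam diam)))) t+2diam<N
      where
      t+2diam<N : t ℕ.+ (diam ℕ.+ diam) < N
      t+2diam<N = <∸⇒+< N (diam ℕ.+ diam) (∈-upTo⁻ t∈)

    diam≤M'⇒separated : diam ℕ.≤ M' → Separated
    diam≤M'⇒separated diam≤M' d d' d∈ d'∈ same-height _ with ∈-map⁻ (λ a → + a - + R) d∈ | ∈-map⁻ (λ a → + a - + R) d'∈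
    ... | a , a∈ , refl | a' , a'∈ , refl =
      cong (λ t → + t - + R) (succ^-injective (height i₀ (- + R)) (bound a∈) (bound a'∈)
                               (trans (sym (from-base a)) (trans same-height (from-base a'))))
      where
      bound : ∀ {a} → a ∈ upTo (suc diam) → a < M
      bound a∈ = ℕP.≤-<-trans (ℕP.≤-pred (∈-upTo⁻ a∈)) (s≤s diam≤M')
      from-base : ∀ a → height i₀ (+ a - + R) ≡ succ^ a (height i₀ (- + R))
      from-base a = trans (cong (height i₀) (ℤP.+-comm (+ a) (- + R))) (height-+ i₀ (- + R) a)

    Collision : ℤ → ℤ → Set
    Collision d d' = d ≢ d' × All (λ l → ŵ₀ (d + + l) ≡ ŵ₀ (d' + + l)) window

    collision? : ∀ d d' → Dec (Collision d d')
    collision? d d' = ¬? (d ℤP.≟ d') ×-dec all? (λ l → ŵ₀ (d + + l) Fin.≟ ŵ₀ (d' + + l)) window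

    separated⊎collision : Separated ⊎ (Σ ℤ λ d → Σ ℤ λ d' → d ∈ offsets × d' ∈ offsets × Collision d d')
    separated⊎collision with any? (λ d → any? (collision? d) offsets) offsets
    ... | yes c = let (d , d∈ , c′) = find c ; (d' , d'∈ , col) = find c′ in inj₂ (d , d' , d∈ , d'∈ , col)
    ... | no ¬c = inj₁ λ d d' d∈ d'∈ _ agree → decidable-stable (d ℤP.≟ d')
                          (λ d≢d' → ¬c (lose d∈ (lose d'∈ (d≢d' , agree))))

    module _ (Lc : ℕ) (long : diam ℕ.+ Lc ℕ.+ (diam ℕ.+ diam) ℕ.≤ N) where

      open PeriodicWords N Lc (R ℕ.+ diam)

      private
        ŵ₀-window : ∀ a R t → (a - R) + ((R + R) + t) ≡ a + (R + t)
        ŵ₀-window = solve-∀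
        realign : ∀ a c R s → a ℕ.+ (R ℕ.+ (c ℕ.+ s)) ≡ R ℕ.+ (a ℕ.+ c) ℕ.+ s
        realign = ℕS.solve-∀
        realign′ : ∀ a p c R s → (suc a ℕ.+ p) ℕ.+ (R ℕ.+ (c ℕ.+ s)) ≡ R ℕ.+ (a ℕ.+ c) ℕ.+ s ℕ.+ suc p
        realign′ = ℕS.solve-∀

      -- Two offsets a - R < a' - R agreeing on the window make w₀ periodic with period a' - a
      -- on the Lc letters from position R + 2R on, which the window covers.
      collision⇒periodic′ : ∀ a a' → a < a' → a' ℕ.≤ diam →
                            All (λ l → ŵ₀ ((+ a - + R) + + l) ≡ ŵ₀ ((+ a' - + R) + + l)) window →
                            Periodic (a' ∸ suc a) w₀
      collision⇒periodic′ a a' a<a' a'≤diam agree s s<Lc = begin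
        at w₀ (R ℕ.+ diam ℕ.+ s)                  ≡⟨ cong (λ x → at w₀ (R ℕ.+ x ℕ.+ s)) (sym a+c≡diam) ⟩
        at w₀ (R ℕ.+ (a ℕ.+ c) ℕ.+ s)             ≡⟨ cong (at w₀) (sym (realign a c R s)) ⟩
        at w₀ (a ℕ.+ (R ℕ.+ t))                   ≡⟨ sym (ŵ₀-at a) ⟩
        ŵ₀ ((+ a - + R) + + (diam ℕ.+ t))         ≡⟨ All.lookup agree t∈window ⟩
        ŵ₀ ((+ a' - + R) + + (diam ℕ.+ t))        ≡⟨ ŵ₀-at a' ⟩
        at w₀ (a' ℕ.+ (R ℕ.+ t))                  ≡⟨ cong (λ x → at w₀ (x ℕ.+ (R ℕ.+ t))) (sym (ℕP.m+[n∸m]≡n a<a')) ⟩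
        at w₀ (suc a ℕ.+ p ℕ.+ (R ℕ.+ t))         ≡⟨ cong (at w₀) (realign′ a p c R s) ⟩
        at w₀ (R ℕ.+ (a ℕ.+ c) ℕ.+ s ℕ.+ suc p)   ≡⟨ cong (λ x → at w₀ (R ℕ.+ x ℕ.+ s ℕ.+ suc p)) a+c≡diam ⟩
        at w₀ (R ℕ.+ diam ℕ.+ s ℕ.+ suc p)        ∎
        where
        c = diam ∸ a
        p = a' ∸ suc a
        t = c ℕ.+ s
        a+c≡diam : a ℕ.+ c ≡ diam
        a+c≡diam = ℕP.m+[n∸m]≡n (ℕP.≤-trans (ℕP.<⇒≤ a<a') a'≤diam)
        ŵ₀-at : ∀ b → ŵ₀ ((+ b - + R) + + (diam ℕ.+ t)) ≡ at w₀ (b ℕ.+ (R ℕ.+ t))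
        ŵ₀-at b = cong ŵ₀ (ŵ₀-window (+ b) (+ R) (+ t))
        t∈window : diam ℕ.+ t ∈ window
        t∈window = ∈-map⁺ (diam ℕ.+_) (∈-upTo⁺ (ℕP.<-≤-trans (ℕP.+-monoʳ-< c s<Lc)
          (ℕP.≤-trans (ℕP.+-monoˡ-≤ Lc (ℕP.m∸n≤m diam a)) (ℕP.m+n≤o⇒m≤o∸n (diam ℕ.+ Lc) long))))

      private
        ≤diam : ∀ {a} → a ∈ upTo (suc diam) → a ℕ.≤ diam
        ≤diam a∈ = ℕP.≤-pred (∈-upTo⁻ a∈)
        period<diam : ∀ {a a'} → a < a' → a' ℕ.≤ diam → a' ∸ suc a < diam
        period<diam a<a' a'≤diam = ℕP.<-≤-trans (ℕP.∸-monoʳ-< (s≤s z≤n) a<a') a'≤diam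

      collision⇒periodic : ∀ {d d'} → d ∈ offsets → d' ∈ offsets → Collision d d' →
                           Σ ℕ λ p → p < diam × Periodic p w₀
      collision⇒periodic d∈ d'∈ (d≢d' , agree) with ∈-map⁻ (λ a → + a - + R) d∈ | ∈-map⁻ (λ a → + a - + R) d'∈
      ... | a , a∈ , refl | a' , a'∈ , refl with ℕP.<-cmp a a'
      ...   | tri≈ _ a≡a' _ = ⊥-elim (d≢d' (cong (λ x → + x - + R) a≡a'))
      ...   | tri< a<a' _ _ = a' ∸ suc a , period<diam a<a' (≤diam a'∈) , collision⇒periodic′ a a' a<a' (≤diam a'∈) agree
      ...   | tri> _ _ a'<a = a ∸ suc a' , period<diam a'<a (≤diam a∈) , collision⇒periodic′ a' a a'<a (≤diam a∈) (All.map sym agree)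


    module _ (separated : Separated) where

      section-π : ∀ v → InBall SW∞ (replicate N 0ₖ , 0ℤ) R v → section (π v) ≡ v
      section-π (x , d) b with ball⇒Quiet b
      ... | lo , hi , blank = cong₂ _,_ (trans (cong unstamp d′≡d) (at-ext _ _ unstamp-d)) d′≡d
        where
        x̂ = tab N (stamp x d)
        unstamp : ℤ → Vec (Fin k) N
        unstamp d′ = tab N (λ l → at x̂ l -ₖ ŵ₀ (d′ + + l))
        unstamp-d : ∀ l → l < N → at (unstamp d) l ≡ at x l
        unstamp-d l h = trans (at-tab N _ l h) (trans (cong (_-ₖ ŵ₀ (d + + l)) (at-tab N (stamp x d) l h)) (a+b-b≡a (at x l) _))
        matches : Matches x̂ d
        matches = All.tabulate λ {l} l∈ → let (a₁ , a₂ , l<N) = window-blank d lo hi l∈ in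
          trans (at-tab N (stamp x d) l l<N) (trans (cong (_+ₖ ŵ₀ (d + + l)) (blank l a₁ a₂)) (+ₖ-identityˡ _))
        d∈ : d ∈ offsets
        d∈ = ∈-offsets d lo hi
        chosen = chosenOffset-fits x̂ (height i₀ d) (lose d∈ (refl , matches))
        d′ = chosenOffset x̂ (height i₀ d)
        d′≡d : d′ ≡ d
        d′≡d = separated d′ d (proj₁ chosen) d∈ (proj₁ (proj₂ chosen))
                 (All.zipWith (λ (p , q) → trans (sym p) q) (proj₂ (proj₂ chosen) , matches))

      open Balls.Covering SW∞ Vₘ Eₘ (OGraph.ι SWₘ) (OGraph.τ SWₘ) (replicate N 0ₖ , 0ℤ) (w₀ , i₀) r

      π-root : π (replicate N 0ₖ , 0ℤ) ≡ (w₀ , i₀)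
      π-root = cong (_, i₀) (at-ext _ _ λ l h →
        trans (at-tab N _ l h) (trans (cong (_+ₖ at w₀ l) (at-replicate N l)) (+ₖ-identityˡ _)))

      covering : Covering
      covering = record
        { π = π ; πᴱ = πᴱ
        ; π-cong  = λ { refl → refl }
        ; πᴱ-cong = λ { refl → refl }
        ; π-ι = λ _ → refl
        ; π-τ = π-τ
        ; liftOut   = liftOut
        ; liftOut-ι = λ _ _ _ → refl
        ; π-liftOut = π-liftOut
        ; liftIn    = liftIn
        ; πᴱ-injectiveOut = πᴱ-injectiveOut
        ; section   = section
        ; section-π = section-π
        ; π-root    = π-root
        }

      SW∞≅SWₘ : BallIso r (SWinfRooted k N) (SWₘ ,root (w₀ , i₀))
      SW∞≅SWₘ = covering⇒BallIso covering

module Counting where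

  open import Data.Nat using (_+_; _*_; _^_)
  open import Data.List using (List; []; _∷_; length; map; cartesianProductWith; allFin)
  open import Data.List.Properties using (length-++; length-map; length-tabulate)
  open import Data.Vec using (_∷_)

  length-cartesianProductWith : ∀ {X Y Z : Set} (f : X → Y → Z) xs ys →
                                length (cartesianProductWith f xs ys) ≡ length xs * length ys
  length-cartesianProductWith f []       ys = refl
  length-cartesianProductWith f (x ∷ xs) ys =
    trans (length-++ (map (f x) ys)) (cong₂ _+_ (length-map (f x) ys) (length-cartesianProductWith f xs ys))

  length-allFin : ∀ n → length (allFin n) ≡ n
  length-allFin n = length-tabulate {n = n} (λ i → i)

  length-allVecs : ∀ k n → length (allVecs k n) ≡ k ^ n
  length-allVecs k zero    = refl
  length-allVecs k (suc n) = trans (length-cartesianProductWith _∷_ (allFin k) (allVecs k n))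
                                   (cong₂ _*_ (length-allFin k) (length-allVecs k n))

open import Data.Nat using (_≤_)
open import Data.Product using (_×_; _,_)

module Convergence {k : ℕ} .{{_ : NonZero k}} (2≤k : 2 ≤ k) where

  open import Data.Nat using (_+_; _*_; _^_; _∸_; _<_; _≤_; s≤s; z≤n)
  import Data.Nat.Properties as ℕP
  open import Data.Nat.Tactic.RingSolver using (solve-∀)
  open import Data.List using (List; []; length; cartesianProduct; allFin; upTo)
  open import Data.List.Properties using (length-upTo)
  open import Data.List.Membership.Propositional using (_∈_)
  open import Data.List.Membership.Propositional.Properties using (∈-cartesianProduct⁺; ∈-allFin)
  open import Data.Product using (∃; _×_; _,_)
  open import Data.Sum using (inj₁; inj₂)
  open import Data.Empty using (⊥-elim)
  open import Relation.Nullary using (¬_)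
  open Balls using (BallIso-sym; BallIso-trans)
  open Counting

  n≤2^n : ∀ n → n ≤ 2 ^ n
  n≤2^n zero    = z≤n
  n≤2^n (suc n) = ℕP.+-mono-≤ (ℕP.m^n>0 2 n) (ℕP.≤-trans (n≤2^n n) (ℕP.m≤m+n (2 ^ n) 0))

  n≤k^n : ∀ n → n ≤ k ^ n
  n≤k^n n = ℕP.≤-trans (n≤2^n n) (ℕP.^-monoˡ-≤ n 2≤k)

  private
    4R≡diam+diam : ∀ R → R + R + R + R ≡ (R + R) + (R + R)
    4R≡diam+diam = solve-∀
    rearrange : ∀ d L → d + d + d + L ≡ d + L + (d + d)
    rearrange = solve-∀
    reassoc : ∀ m d K M → m * (d * K * M) ≡ m * d * K * M
    reassoc = solve-∀

  Cay≅SW∞ : ∀ r N → suc r + suc r + suc r + suc r ≤ N → BallIso r (CayRooted k) (SWinfRooted k N)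
  Cay≅SW∞ r zero ()
  Cay≅SW∞ r (suc N₁) 4R≤N = CayleyCovering.Unfold.Cay≅SW∞ N₁ r 4R≤N

  module _ (r m : ℕ) where

    R diam Lc N₀ : ℕ
    R = suc r
    diam = R + R
    Lc = m * diam
    N₀ = diam + Lc + (diam + diam)

    module _ (N M' : ℕ) (N₀≤N : N₀ ≤ N) where

      open PeriodicWords {k} N Lc (R + diam) using (candidates; periodic∈candidates)

      private
        4R≤N : R + R + R + R ≤ N
        4R≤N = ℕP.≤-trans (ℕP.≤-reflexive (4R≡diam+diam R))
                 (ℕP.≤-trans (ℕP.m≤n+m (diam + diam) (diam + Lc)) N₀≤N)
        period-fits : ∀ p → p < diam → R + diam + suc p + Lc ≤ N
        period-fits p p<diam = ℕP.≤-trans (ℕP.+-monoˡ-≤ Lc (ℕP.+-mono-≤ (ℕP.+-monoˡ-≤ diam (ℕP.m≤m+n R R)) p<diam))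
                                          (subst (_≤ N) (sym (rearrange diam Lc)) N₀≤N)

      badRoots : List (Vec (Fin k) N × Fin (suc M'))
      badRoots = cartesianProduct (candidates diam) (allFin (suc M'))

      module _ (w₀ : Vec (Fin k) N) (i₀ : Fin (suc M')) where

        open WrapCovering N M' w₀ i₀ using (module Unwrap)
        open Unwrap r using (separated⊎collision; SW∞≅SWₘ; collision⇒periodic)

        nonIsomorphic⇒periodic : ¬ BallIso r (SWfinGraph k N M' ,root (w₀ , i₀)) (CayRooted k) → w₀ ∈ candidates diam
        nonIsomorphic⇒periodic ¬iso with separated⊎collision
        ... | inj₁ separated = ⊥-elim (¬iso (BallIso-sym (BallIso-trans (Cay≅SW∞ r N 4R≤N) (SW∞≅SWₘ separated))))
        ... | inj₂ (_ , _ , d∈ , d'∈ , collision) with collision⇒periodic Lc N₀≤N d∈ d'∈ collision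
        ...   | p , p<diam , periodic = periodic∈candidates diam p w₀ p<diam periodic (period-fits p p<diam)

      nonIsomorphic⇒bad : ∀ x → ¬ BallIso r (SWfinGraph k N M' ,root x) (CayRooted k) → x ∈ badRoots
      nonIsomorphic⇒bad (w₀ , i₀) ¬iso = ∈-cartesianProduct⁺ (nonIsomorphic⇒periodic w₀ i₀ ¬iso) (∈-allFin i₀)

      badRoots-few : m * length badRoots ≤ length (cartesianProduct (allVecs k N) (allFin (suc M')))
      badRoots-few = begin
        m * length badRoots           ≡⟨ cong (m *_) length-bad ⟩
        m * (diam * K * M)            ≡⟨ reassoc m diam K M ⟩
        Lc * K * M                    ≤⟨ ℕP.*-monoˡ-≤ M (ℕP.*-monoˡ-≤ K (n≤k^n Lc)) ⟩
        k ^ Lc * K * M                ≡⟨ cong (_* M) (trans (ℕP.*-comm (k ^ Lc) K) (sym k^N≡K*k^Lc)) ⟩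
        k ^ N * M                     ≡⟨ sym length-all ⟩
        length (cartesianProduct (allVecs k N) (allFin M)) ∎
        where
        open ℕP.≤-Reasoning
        M = suc M'
        K = k ^ (N ∸ Lc)
        length-bad : length badRoots ≡ diam * K * M
        length-bad = trans (length-cartesianProductWith _,_ (candidates diam) (allFin M))
          (cong₂ _*_ (trans (length-cartesianProductWith _ (upTo diam) (allVecs k (N ∸ Lc)))
                            (cong₂ _*_ (length-upTo diam) (length-allVecs k (N ∸ Lc))))
                     (length-allFin M))
        length-all : length (cartesianProduct (allVecs k N) (allFin M)) ≡ k ^ N * M
        length-all = trans (length-cartesianProductWith _,_ (allVecs k N) (allFin M))
                           (cong₂ _*_ (length-allVecs k N) (length-allFin M))
        k^N≡K*k^Lc : k ^ N ≡ K * k ^ Lc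
        k^N≡K*k^Lc = trans (cong (k ^_) (sym (ℕP.m∸n+n≡m (ℕP.≤-trans (ℕP.≤-trans (ℕP.m≤n+m Lc diam) (ℕP.m≤m+n (diam + Lc) (diam + diam))) N₀≤N))))
                           (ℕP.^-distribˡ-+-* k (N ∸ Lc) Lc)

    SW→Cay : ∃ λ N₀ → ∀ N M' → N₀ ≤ N → BadFraction≤ r m (SWfin k N M') (CayRooted k)
    SW→Cay = N₀ , λ N M' N₀≤N → badRoots N M' N₀≤N , nonIsomorphic⇒bad N M' N₀≤N , badRoots-few N M' N₀≤N

  SWₘ→SW∞ : ∀ N → BSConverges (λ M' → SWfin k N M') (SWinfRooted k N)
  SWₘ→SW∞ N r m = suc r + suc r , λ M' diam≤M' →
    [] , (λ x ¬iso → ⊥-elim (¬iso (BallIso-sym (isomorphic M' x diam≤M')))) , subst (_≤ length (cartesianProduct (allVecs k N) (allFin (suc M')))) (sym (ℕP.*-zeroʳ m)) z≤n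
    where
    isomorphic : ∀ M' x → suc r + suc r ≤ M' → BallIso r (SWinfRooted k N) (SWfinGraph k N M' ,root x)
    isomorphic M' (w₀ , i₀) diam≤M' = SW∞≅SWₘ (diam≤M'⇒separated diam≤M')
      where open WrapCovering N M' w₀ i₀ using (module Unwrap) ; open Unwrap r using (SW∞≅SWₘ; diam≤M'⇒separated)

  SW∞→Cay : RootedConverges (λ N → SWinfRooted k N) (CayRooted k)
  SW∞→Cay r = suc r + suc r + suc r + suc r , λ N 4R≤N → BallIso-sym (Cay≅SW∞ r N 4R≤N)

theorem4p17 : ∀ (k : ℕ) .{{_ : NonZero k}} → 2 ≤ k →
    BSConverges (λ N → deBruijn k N) (CayRooted k)
    × (∀ (M' : ℕ) → BSConverges (λ N → SWfin k N M') (CayRooted k))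
    × (∀ (N : ℕ) → BSConverges (λ M' → SWfin k N M') (SWinfRooted k N))
    × RootedConverges (λ N → SWinfRooted k N) (CayRooted k)
    × BSConverges₂ (λ N M' → SWfin k N M') (CayRooted k)
theorem4p17 k 2≤k =
    (λ r m → let (N₀ , bad) = SW→Cay r m in N₀ , λ N N₀≤N → bad N 0 N₀≤N)
  , (λ M' r m → let (N₀ , bad) = SW→Cay r m in N₀ , λ N N₀≤N → bad N M' N₀≤N)
  , SWₘ→SW∞
  , SW∞→Cay
  , (λ r m → let (N₀ , bad) = SW→Cay r m in N₀ , λ N M' N₀≤N _ → bad N M' N₀≤N)
  where open Convergence 2≤k
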